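{- Let $y$ be an indeterminate and work over the field $\mathbb{Q}(y)$. Define the polynomials $P_n(y)$ by $$\sum_{n\ge0}P_n(y)\frac{x^n}{n!}=\frac{(y-1)e^{xy}}{y-e^{(y-1)x}}.$$ Then $(P_n(y))_{n\ge0}$ is the moment sequence for the family of orthogonal polynomials whose moment matrix is the exponential Riordan array $$\left[\frac{(y-1)e^{xy}}{y-e^{(y-1)x}},\ \frac{e^x-e^{xy}}{e^{xy}-ye^x}\right];$$ that is, this exponential Riordan array has a tridiagonal production matrix, and its first column is $(P_n(y))_{n\ge0}$.
   Context: For a power series $G(x)$ with $G(0)\ne0$ and a power series $F(x)$ with $F(0)=0$, $F'(0)\ne0$, the exponential Riordan array $[G,F]$ is the infinite lower-triangular matrix $(a_{n,k})_{n,k\ge0}$ with $a_{n,k}=\frac{n!}{k!}[x^n]G(x)F(x)^k$. For an invertible lower-triangular matrix $M$, its production matrix is $M^{ -1}\overline{M}$, where $\overline{M}$ is $M$ with its first row removed (i.e. $\overline{M}_{n,k}=M_{n+1,k}$). A lower-triangular matrix $M$ is the moment matrix of a family of orthogonal polynomials when its production matrix is tridiagonal (with superdiagonal entries equal to $1$); then $M^{ -1}$ is the coefficient array of the orthogonal polynomials and the first column of $M$ is their moment sequence. -}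

module Defs where

open import Data.Bool using (if_then_else_)
open import Data.Nat as ℕ using (ℕ; zero; suc; _∸_; _≤ᵇ_; _!)
open import Data.Integer using (+_)
open import Data.Rational as ℚ using (ℚ; 0ℚ; 1ℚ)
open import Data.Rational.Properties using () renaming (_≟_ to _≟ℚ_)
open import Relation.Nullary using (yes; no)
open import Relation.Binary.PropositionalEquality using (_≡_)

ℕtoℚ : ℕ → ℚ
ℕtoℚ n = (+ n) ℚ./ 1

-- multiplicative inverse of a rational; only ever applied to nonzero
-- arguments below (value 0 at 0 is an irrelevant junk value)
invℚ : ℚ → ℚ
invℚ q with q ≟ℚ 0ℚ
... | yes _ = 0ℚ
... | no q≢0 = ℚ.1/_ q {{ℚ.≢-nonZero q≢0}}

-- Course-of-values recursion: cov b step n is the n-th term of the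
-- sequence u with u 0 = b and u (suc n) = step n h, where h m = u m
-- for all m ≤ n.

private
  hist : {A : Set} → A → (ℕ → (ℕ → A) → A) → ℕ → ℕ → A
  hist b step zero = λ _ → b
  hist b step (suc n) m =
    if m ≤ᵇ n then hist b step n m else step n (hist b step n)

cov : {A : Set} → A → (ℕ → (ℕ → A) → A) → ℕ → A
cov b step n = hist b step n n

sumBelow : {A : Set} → A → (A → A → A) → ℕ → (ℕ → A) → A
sumBelow z _⊕_ zero f = z
sumBelow z _⊕_ (suc n) f = sumBelow z _⊕_ n f ⊕ f n

-- S = ℚ[[y]] : formal power series in y (coefficient of y^m at m)

S : Set
S = ℕ → ℚ

_≐_ : S → S → Set
f ≐ g = ∀ m → f m ≡ g m
infix 4 _≐_

0S : S
0S _ = 0ℚ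

1S : S
1S zero = 1ℚ
1S (suc _) = 0ℚ

yS : S
yS (suc zero) = 1ℚ
yS _ = 0ℚ

_+S_ : S → S → S
(f +S g) m = f m ℚ.+ g m
infixl 6 _+S_

-S_ : S → S
(-S f) m = ℚ.- (f m)

_-S_ : S → S → S
f -S g = f +S (-S g)
infixl 6 _-S_

ΣS : ℕ → (ℕ → S) → S
ΣS = sumBelow 0S _+S_

_*S_ : S → S → S
(f *S g) m = sumBelow 0ℚ ℚ._+_ (suc m) (λ i → f i ℚ.* g (m ∸ i))
infixl 7 _*S_

scaleS : ℚ → S → S
scaleS q f m = q ℚ.* f m

powS : S → ℕ → S
powS f zero = 1S
powS f (suc k) = f *S powS f k

invS : S → S
invS a = cov c (λ n h → ℚ.- (c ℚ.* sumBelow 0ℚ ℚ._+_ (suc n)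
                                      (λ j → a (suc j) ℚ.* h (n ∸ j))))
  where c = invℚ (a 0)

-- X = ℚ[[y]][[x]] : formal power series in x with coefficients in S
-- (coefficient of x^n at n)

X : Set
X = ℕ → S

constX : S → X
constX c zero = c
constX c (suc _) = 0S

_+X_ : X → X → X
(f +X g) n = f n +S g n
infixl 6 _+X_

_-X_ : X → X → X
(f -X g) n = f n -S g n
infixl 6 _-X_

_*X_ : X → X → X
(f *X g) n = ΣS (suc n) (λ i → f i *S g (n ∸ i))
infixl 7 _*X_

powX : X → ℕ → X
powX f zero = constX 1S
powX f (suc k) = f *X powX f k

invX : X → X
invX a = cov c (λ n h → -S (c *S ΣS (suc n) (λ j → a (suc j) *S h (n ∸ j))))
  where c = invS (a 0)

expX : S → X
expX c n = scaleS (invℚ (ℕtoℚ (n !))) (powS c n)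

Mat : Set
Mat = ℕ → ℕ → S

LowerTriangular : Mat → Set
LowerTriangular M = ∀ n k → n ℕ.< k → M n k ≐ 0S

expRiordan : X → X → Mat
expRiordan G F n k =
  scaleS (ℕtoℚ (n !) ℚ.* invℚ (ℕtoℚ (k !))) ((G *X powX F k) n)

idMat : Mat
idMat n k = if (n ≤ᵇ k) Data.Bool.∧ (k ≤ᵇ n) then 1S else 0S
  where import Data.Bool

-- product A·B where A is lower triangular (so the sum over j is finite:
-- (A·B)_{n,k} = Σ_{j ≤ n} A_{n,j} B_{j,k})
_·LT_ : Mat → Mat → Mat
(A ·LT B) n k = ΣS (suc n) (λ j → A n j *S B j k)

-- inverse of a lower-triangular matrix with invertible diagonal,
-- by forward substitution:
--   (M⁻¹)_{k,k} = M_{k,k}⁻¹,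
--   (M⁻¹)_{n,k} = - M_{n,n}⁻¹ Σ_{k ≤ j < n} M_{n,j} (M⁻¹)_{j,k}   (n > k),
--   (M⁻¹)_{n,k} = 0   (n < k).
invLT : Mat → Mat
invLT M n k = if k ≤ᵇ n then column (n ∸ k) else 0S
  where
  column : ℕ → S
  column = cov (invS (M k k))
    (λ d h → -S (invS (M (k ℕ.+ suc d) (k ℕ.+ suc d))
               *S ΣS (suc d) (λ j → M (k ℕ.+ suc d) (k ℕ.+ j) *S h j)))

dropRow : Mat → Mat
dropRow M n k = M (suc n) k

production : Mat → Mat
production M = invLT M ·LT dropRow M

Ggf : X
Ggf = constX (yS -S 1S) *X expX yS
        *X invX (constX yS -X expX (yS -S 1S))

Fgf : X
Fgf = (expX 1S -X expX yS) *X invX (expX yS -X constX yS *X expX 1S)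

P : ℕ → S
P n = scaleS (ℕtoℚ (n !)) (Ggf n)

Mom : Mat
Mom = expRiordan Ggf Fgf

module Submission where

-- Write M = [G, F] with columns Cₖ = G Fᵏ, so that M n k = n!/k! [xⁿ] Cₖ and the
-- shifted matrix M̄ corresponds to d/dx. F solves the Riccati equation
-- F′ = (1 + F)(1 + y F) and G solves G′ = G (1 + y + y F); hence
--   Cₖ′ = k Cₖ₋₁ + (k + 1)(1 + y) Cₖ + (k + 1) y Cₖ₊₁,
-- which in matrix form says M̄ = M T with T tridiagonal (entries 1 above the
-- diagonal, (k + 1)(1 + y) on it, (k + 1)² y below it). Since F = x + O(x²) and
-- G = 1 + O(x), M is lower unitriangular, so its production matrix M⁻¹ M̄ is T.

open import Defs
open import Data.Nat using (ℕ; suc; _<_)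
open import Data.Product using (_×_)

open import Algebra using (CommutativeRing)
import Algebra.Solver.Ring as RingSolver
import Algebra.Solver.Ring.AlmostCommutativeRing as ACR
open import Data.Bool using (Bool; true; false; if_then_else_)
open import Data.Empty using (⊥-elim)
open import Data.Integer as ℤ using (+_)
import Data.Integer.Properties as ℤP
open import Data.Maybe using (Maybe; just; nothing)
open import Data.Nat as ℕ using (zero; _∸_; _≤_; z≤n; s≤s; _≤ᵇ_; _!)
import Data.Nat.Coprimality as Coprime
import Data.Nat.Properties as ℕP
open import Data.Product using (Σ-syntax; _,_; proj₁; proj₂)
open import Data.Rational as ℚ using (ℚ; 0ℚ; 1ℚ; mkℚ)
import Data.Rational.Properties as ℚP
open import Data.Sum using (inj₁; inj₂)
open import Level using (0ℓ)
open import Relation.Binary.Definitions using (tri<; tri≈; tri>)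
open import Relation.Binary.PropositionalEquality as ≡ using (_≡_; _≢_)
open import Relation.Nullary using (¬_; does; yes; no)
open import Relation.Nullary.Decidable using (dec-true; dec-false)

≤⇒≤ᵇ≡true : ∀ {m n} → m ≤ n → (m ≤ᵇ n) ≡ true
≤⇒≤ᵇ≡true z≤n = ≡.refl
≤⇒≤ᵇ≡true (s≤s z≤n) = ≡.refl
≤⇒≤ᵇ≡true (s≤s (s≤s p)) = ≤⇒≤ᵇ≡true (s≤s p)

>⇒≤ᵇ≡false : ∀ {m n} → n < m → (m ≤ᵇ n) ≡ false
>⇒≤ᵇ≡false {suc m} {zero} p = ≡.refl
>⇒≤ᵇ≡false {suc zero} {suc n} (s≤s ())
>⇒≤ᵇ≡false {suc (suc m)} {suc n} (s≤s p) = >⇒≤ᵇ≡false p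

if-true : {A : Set} {b : Bool} {x y : A} → b ≡ true → (if b then x else y) ≡ x
if-true ≡.refl = ≡.refl

if-false : {A : Set} {b : Bool} {x y : A} → b ≡ false → (if b then x else y) ≡ y
if-false ≡.refl = ≡.refl

module CourseOfValues {A : Set} (b : A) (step : ℕ → (ℕ → A) → A) where

  -- Defs keeps the history table of cov private; unification recovers it as
  -- the first component.
  private
    history : Σ[ H ∈ (ℕ → ℕ → A) ] (∀ n → cov b step (suc n) ≡ step n (H n))
    history = _ , λ n → if-false (>⇒≤ᵇ≡false (ℕP.n<1+n n))

  table : ℕ → ℕ → A
  table = proj₁ history

  cov-suc : ∀ n → cov b step (suc n) ≡ step n (table n)
  cov-suc n = if-false (>⇒≤ᵇ≡false (ℕP.n<1+n n))

  table-cov : ∀ n m → m ≤ n → table n m ≡ cov b step m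
  table-cov zero .zero z≤n = ≡.refl
  table-cov (suc n) m p with ℕP.m≤n⇒m<n∨m≡n p
  ... | inj₁ (s≤s q) = ≡.trans (if-true (≤⇒≤ᵇ≡true q)) (table-cov n m q)
  ... | inj₂ ≡.refl = ≡.refl

module FiniteSums (R : CommutativeRing 0ℓ 0ℓ) where
  open CommutativeRing R
  open import Relation.Binary.Reasoning.Setoid setoid
  open import Algebra.Properties.CommutativeSemigroup +-commutativeSemigroup using (interchange)

  Σ< : ℕ → (ℕ → Carrier) → Carrier
  Σ< = sumBelow 0# _+_

  Σ-cong : ∀ n {f g} → (∀ i → i < n → f i ≈ g i) → Σ< n f ≈ Σ< n g
  Σ-cong zero h = refl
  Σ-cong (suc n) h = +-cong (Σ-cong n (λ i p → h i (ℕP.m<n⇒m<1+n p))) (h n (ℕP.n<1+n n))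

  Σ-cong′ : ∀ n {f g} → (∀ i → f i ≈ g i) → Σ< n f ≈ Σ< n g
  Σ-cong′ n h = Σ-cong n (λ i _ → h i)

  Σ-length : ∀ {n m} f → n ≡ m → Σ< n f ≈ Σ< m f
  Σ-length f e = reflexive (≡.cong (λ k → Σ< k f) e)

  Σ-+ : ∀ n f g → Σ< n (λ i → f i + g i) ≈ Σ< n f + Σ< n g
  Σ-+ zero f g = sym (+-identityˡ 0#)
  Σ-+ (suc n) f g = trans (+-cong (Σ-+ n f g) refl) (interchange _ _ _ _)

  *-Σ : ∀ n a f → a * Σ< n f ≈ Σ< n (λ i → a * f i)
  *-Σ zero a f = zeroʳ a
  *-Σ (suc n) a f = trans (distribˡ a _ _) (+-cong (*-Σ n a f) refl)

  Σ-* : ∀ n a f → Σ< n f * a ≈ Σ< n (λ i → f i * a)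
  Σ-* n a f = trans (*-comm _ a) (trans (*-Σ n a f) (Σ-cong′ n (λ i → *-comm a (f i))))

  Σ-zero : ∀ n {f} → (∀ i → i < n → f i ≈ 0#) → Σ< n f ≈ 0#
  Σ-zero zero h = refl
  Σ-zero (suc n) h =
    trans (+-cong (Σ-zero n (λ i p → h i (ℕP.m<n⇒m<1+n p))) (h n (ℕP.n<1+n n))) (+-identityˡ 0#)

  Σ-head : ∀ n f → Σ< (suc n) f ≈ f 0 + Σ< n (λ i → f (suc i))
  Σ-head zero f = +-comm 0# (f 0)
  Σ-head (suc n) f = trans (+-cong (Σ-head n f) refl) (+-assoc _ _ _)

  Σ-reverse : ∀ n f → Σ< n f ≈ Σ< n (λ i → f (n ∸ suc i))
  Σ-reverse zero f = refl
  Σ-reverse (suc n) f = begin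
    Σ< n f + f n                              ≈⟨ +-comm _ _ ⟩
    f n + Σ< n f                              ≈⟨ +-cong refl (Σ-reverse n f) ⟩
    f (n ∸ 0) + Σ< n (λ i → f (n ∸ suc i))    ≈⟨ Σ-head n (λ i → f (n ∸ i)) ⟨
    Σ< (suc n) (λ i → f (n ∸ i))              ∎

  Σ-single : ∀ n m {f} → m < n → (∀ i → i < n → ¬ (i ≡ m) → f i ≈ 0#) → Σ< n f ≈ f m
  Σ-single (suc n) m {f} (s≤s p) h with ℕP.m≤n⇒m<n∨m≡n p
  ... | inj₁ q = trans (+-cong (Σ-single n m q (λ i r ne → h i (ℕP.m<n⇒m<1+n r) ne))
                               (h n (ℕP.n<1+n n) (λ e → ℕP.<-irrefl (≡.sym e) q)))
                       (+-identityʳ _)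
  ... | inj₂ ≡.refl = trans (+-cong (Σ-zero n (λ i r → h i (ℕP.m<n⇒m<1+n r) (λ e → ℕP.<-irrefl e r))) refl)
                            (+-identityˡ _)

  Σ-split : ∀ m n f → Σ< (m ℕ.+ n) f ≈ Σ< m f + Σ< n (λ i → f (m ℕ.+ i))
  Σ-split m zero f = trans (Σ-length f (ℕP.+-identityʳ m)) (sym (+-identityʳ _))
  Σ-split m (suc n) f = begin
    Σ< (m ℕ.+ suc n) f                                        ≈⟨ Σ-length f (ℕP.+-suc m n) ⟩
    Σ< (m ℕ.+ n) f + f (m ℕ.+ n)                              ≈⟨ +-cong (Σ-split m n f) refl ⟩
    (Σ< m f + Σ< n (λ i → f (m ℕ.+ i))) + f (m ℕ.+ n)         ≈⟨ +-assoc _ _ _ ⟩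
    Σ< m f + (Σ< n (λ i → f (m ℕ.+ i)) + f (m ℕ.+ n))         ∎

  Σ-truncate : ∀ j n g → j ≤ n → (∀ i → j < i → i ≤ n → g i ≈ 0#) → Σ< (suc n) g ≈ Σ< (suc j) g
  Σ-truncate j n g p h = begin
    Σ< (suc n) g                                              ≈⟨ Σ-length g (≡.cong suc (ℕP.m+[n∸m]≡n p)) ⟨
    Σ< (suc j ℕ.+ (n ∸ j)) g                                  ≈⟨ Σ-split (suc j) (n ∸ j) g ⟩
    Σ< (suc j) g + Σ< (n ∸ j) (λ t → g (suc j ℕ.+ t))         ≈⟨ +-cong refl (Σ-zero (n ∸ j) tail) ⟩
    Σ< (suc j) g + 0#                                         ≈⟨ +-identityʳ _ ⟩
    Σ< (suc j) g                                              ∎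
    where
    tail : ∀ t → t < n ∸ j → g (suc j ℕ.+ t) ≈ 0#
    tail t q = h (suc j ℕ.+ t) (s≤s (ℕP.m≤m+n j t))
      (ℕP.≤-trans (ℕP.≤-reflexive (≡.sym (ℕP.+-suc j t)))
        (ℕP.≤-trans (ℕP.+-monoʳ-≤ j q) (ℕP.≤-reflexive (ℕP.m+[n∸m]≡n p))))

  Σ-swap : ∀ a b (f : ℕ → ℕ → Carrier) → Σ< a (λ i → Σ< b (f i)) ≈ Σ< b (λ j → Σ< a (λ i → f i j))
  Σ-swap zero b f = sym (Σ-zero b (λ _ _ → refl))
  Σ-swap (suc a) b f =
    trans (+-cong (Σ-swap a b f) refl) (sym (Σ-+ b (λ j → Σ< a (λ i → f i j)) (f a)))

  Σ-swap-triangle : ∀ N (F : ℕ → ℕ → Carrier) →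
    Σ< N (λ k → Σ< (suc k) (F k)) ≈ Σ< N (λ i → Σ< (N ∸ i) (λ j → F (i ℕ.+ j) i))
  Σ-swap-triangle zero F = refl
  Σ-swap-triangle (suc N) F = begin
    Σ< N (λ k → Σ< (suc k) (F k)) + Σ< (suc N) (F N)  ≈⟨ +-cong (Σ-swap-triangle N F) refl ⟩
    Σ< N A + Σ< (suc N) (F N)                         ≈⟨ +-cong (sym (+-identityʳ _)) refl ⟩
    (Σ< N A + 0#) + Σ< (suc N) (F N)                  ≈⟨ +-cong (+-cong refl (Σ-length (λ j → F (N ℕ.+ j) N) (ℕP.n∸n≡0 N))) refl ⟨
    Σ< (suc N) A + Σ< (suc N) (F N)                   ≈⟨ Σ-+ (suc N) A (F N) ⟨
    Σ< (suc N) (λ i → A i + F N i)                    ≈⟨ Σ-cong (suc N) extend ⟩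
    Σ< (suc N) (λ i → Σ< (suc N ∸ i) (λ j → F (i ℕ.+ j) i)) ∎
    where
    A : ℕ → Carrier
    A i = Σ< (N ∸ i) (λ j → F (i ℕ.+ j) i)
    extend : ∀ i → i < suc N → A i + F N i ≈ Σ< (suc N ∸ i) (λ j → F (i ℕ.+ j) i)
    extend i (s≤s p) =
      trans (+-cong refl (reflexive (≡.cong (λ k → F k i) (≡.sym (ℕP.m+[n∸m]≡n p)))))
            (Σ-length (λ j → F (i ℕ.+ j) i) (≡.sym (ℕP.+-∸-assoc 1 p)))

-- The unit series is a parameter so that it can be instantiated by the series
-- 1S and constX 1S of Defs, which are pointwise but not definitionally κ 1#.
module PowerSeries (R : CommutativeRing 0ℓ 0ℓ)
  (𝟙 : ℕ → CommutativeRing.Carrier R)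
  (𝟙-zero : CommutativeRing._≈_ R (𝟙 0) (CommutativeRing.1# R))
  (𝟙-suc : ∀ n → CommutativeRing._≈_ R (𝟙 (suc n)) (CommutativeRing.0# R)) where

  open CommutativeRing R
  open FiniteSums R public
  open import Relation.Binary.Reasoning.Setoid setoid
  open import Algebra.Properties.Ring ring using (-‿distribʳ-*)
  open import Algebra.Structures using (IsCommutativeRing)

  Series : Set
  Series = ℕ → Carrier

  infix 4 _≋_
  _≋_ : Series → Series → Set
  f ≋ g = ∀ n → f n ≈ g n

  infixl 6 _⊕_
  _⊕_ : Series → Series → Series
  (f ⊕ g) n = f n + g n

  ⊖_ : Series → Series
  (⊖ f) n = - f n

  infixl 7 _⊛_
  _⊛_ : Series → Series → Series
  (f ⊛ g) n = Σ< (suc n) (λ i → f i * g (n ∸ i))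

  𝟘 : Series
  𝟘 _ = 0#

  κ : Carrier → Series
  κ a zero = a
  κ a (suc _) = 0#

  ⊛-cong : ∀ {f f′ g g′} → f ≋ f′ → g ≋ g′ → f ⊛ g ≋ f′ ⊛ g′
  ⊛-cong p q n = Σ-cong′ (suc n) (λ i → *-cong (p i) (q (n ∸ i)))

  ⊛-comm : ∀ f g → f ⊛ g ≋ g ⊛ f
  ⊛-comm f g n = trans (Σ-reverse (suc n) (λ i → f i * g (n ∸ i)))
    (Σ-cong (suc n) (λ i p → trans (*-comm _ _)
       (*-cong (reflexive (≡.cong g (ℕP.m∸[m∸n]≡n (ℕP.≤-pred p)))) refl)))

  ⊛-assoc : ∀ f g h → (f ⊛ g) ⊛ h ≋ f ⊛ (g ⊛ h)
  ⊛-assoc f g h n = begin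
    Σ< (suc n) (λ k → Σ< (suc k) (λ i → f i * g (k ∸ i)) * h (n ∸ k))
      ≈⟨ Σ-cong′ (suc n) (λ k → Σ-* (suc k) _ _) ⟩
    Σ< (suc n) (λ k → Σ< (suc k) (λ i → (f i * g (k ∸ i)) * h (n ∸ k)))
      ≈⟨ Σ-swap-triangle (suc n) (λ k i → (f i * g (k ∸ i)) * h (n ∸ k)) ⟩
    Σ< (suc n) (λ i → Σ< (suc n ∸ i) (λ j → (f i * g (i ℕ.+ j ∸ i)) * h (n ∸ (i ℕ.+ j))))
      ≈⟨ Σ-cong (suc n) inner ⟩
    Σ< (suc n) (λ i → f i * Σ< (suc (n ∸ i)) (λ j → g j * h (n ∸ i ∸ j))) ∎
    where
    inner : ∀ i → i < suc n →
      Σ< (suc n ∸ i) (λ j → (f i * g (i ℕ.+ j ∸ i)) * h (n ∸ (i ℕ.+ j))) ≈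
      f i * Σ< (suc (n ∸ i)) (λ j → g j * h (n ∸ i ∸ j))
    inner i (s≤s p) = begin
      Σ< (suc n ∸ i) (λ j → (f i * g (i ℕ.+ j ∸ i)) * h (n ∸ (i ℕ.+ j)))
        ≈⟨ Σ-length _ (ℕP.+-∸-assoc 1 p) ⟩
      Σ< (suc (n ∸ i)) (λ j → (f i * g (i ℕ.+ j ∸ i)) * h (n ∸ (i ℕ.+ j)))
        ≈⟨ Σ-cong′ (suc (n ∸ i)) (λ j → trans (*-assoc _ _ _)
             (*-cong refl (*-cong (reflexive (≡.cong g (ℕP.m+n∸m≡n i j)))
                                  (reflexive (≡.cong h (≡.sym (ℕP.∸-+-assoc n i j))))))) ⟩
      Σ< (suc (n ∸ i)) (λ j → f i * (g j * h (n ∸ i ∸ j)))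
        ≈⟨ *-Σ (suc (n ∸ i)) (f i) _ ⟨
      f i * Σ< (suc (n ∸ i)) (λ j → g j * h (n ∸ i ∸ j)) ∎

  κ-⊛ : ∀ a f → κ a ⊛ f ≋ (λ n → a * f n)
  κ-⊛ a f n = begin
    Σ< (suc n) (λ i → κ a i * f (n ∸ i))          ≈⟨ Σ-head n _ ⟩
    a * f n + Σ< n (λ i → 0# * f (n ∸ suc i))     ≈⟨ +-cong refl (Σ-zero n (λ i _ → zeroˡ _)) ⟩
    a * f n + 0#                                  ≈⟨ +-identityʳ _ ⟩
    a * f n                                       ∎

  ⊛-identityˡ : ∀ f → 𝟙 ⊛ f ≋ f
  ⊛-identityˡ f n = begin
    Σ< (suc n) (λ i → 𝟙 i * f (n ∸ i))             ≈⟨ Σ-head n _ ⟩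
    𝟙 0 * f n + Σ< n (λ i → 𝟙 (suc i) * f (n ∸ suc i))
      ≈⟨ +-cong (*-cong 𝟙-zero refl) (Σ-zero n (λ i _ → trans (*-cong (𝟙-suc i) refl) (zeroˡ _))) ⟩
    1# * f n + 0#                                  ≈⟨ trans (+-identityʳ _) (*-identityˡ _) ⟩
    f n                                            ∎

  ⊛-identityʳ : ∀ f → f ⊛ 𝟙 ≋ f
  ⊛-identityʳ f n = trans (⊛-comm f 𝟙 n) (⊛-identityˡ f n)

  ⊛-distribˡ : ∀ f g h → f ⊛ (g ⊕ h) ≋ f ⊛ g ⊕ f ⊛ h
  ⊛-distribˡ f g h n = trans (Σ-cong′ (suc n) (λ i → distribˡ _ _ _)) (Σ-+ (suc n) _ _)

  ⊛-distribʳ : ∀ f g h → (g ⊕ h) ⊛ f ≋ g ⊛ f ⊕ h ⊛ f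
  ⊛-distribʳ f g h n = trans (Σ-cong′ (suc n) (λ i → distribʳ _ _ _)) (Σ-+ (suc n) _ _)

  ⊛-isCommutativeRing : IsCommutativeRing _≋_ _⊕_ _⊛_ ⊖_ 𝟘 𝟙
  ⊛-isCommutativeRing = record
    { isRing = record
      { +-isAbelianGroup = record
        { isGroup = record
          { isMonoid = record
            { isSemigroup = record
              { isMagma = record
                { isEquivalence = record
                  { refl = λ n → refl ; sym = λ p n → sym (p n) ; trans = λ p q n → trans (p n) (q n) }
                ; ∙-cong = λ p q n → +-cong (p n) (q n) }
              ; assoc = λ f g h n → +-assoc _ _ _ }
            ; identity = (λ f n → +-identityˡ _) , (λ f n → +-identityʳ _) }
          ; inverse = (λ f n → -‿inverseˡ _) , (λ f n → -‿inverseʳ _)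
          ; ⁻¹-cong = λ p n → -‿cong (p n) }
        ; comm = λ f g n → +-comm _ _ }
      ; *-cong = ⊛-cong
      ; *-assoc = ⊛-assoc
      ; *-identity = ⊛-identityˡ , ⊛-identityʳ
      ; distrib = ⊛-distribˡ , ⊛-distribʳ }
    ; *-comm = ⊛-comm }

  powerSeriesRing : CommutativeRing 0ℓ 0ℓ
  powerSeriesRing = record { isCommutativeRing = ⊛-isCommutativeRing }

  -- The recursion of invS and invX: if c a₀ = 1, then the coefficients of
  -- a⁻¹ are solved for one at a time from (a ⊛ a⁻¹)ₙ = 0.
  inverse : Carrier → Series → Series
  inverse c a = cov c (λ n h → - (c * Σ< (suc n) (λ j → a (suc j) * h (n ∸ j))))

  ⊛-inverse : ∀ c a → c * a 0 ≈ 1# → a ⊛ inverse c a ≋ 𝟙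
  ⊛-inverse c a ca zero = trans (+-identityˡ _) (trans (*-comm _ _) (trans ca (sym 𝟙-zero)))
  ⊛-inverse c a ca (suc m) = begin
    Σ< (suc (suc m)) (λ i → a i * a⁻¹ (suc m ∸ i))   ≈⟨ Σ-head (suc m) _ ⟩
    a 0 * a⁻¹ (suc m) + T                            ≈⟨ +-cong (*-cong refl (reflexive (cov-suc m))) refl ⟩
    a 0 * (- (c * T′)) + T                           ≈⟨ +-cong (*-cong refl (-‿cong (*-cong refl T≈T′))) refl ⟨
    a 0 * (- (c * T)) + T                            ≈⟨ +-cong (-‿distribʳ-* _ _) refl ⟨
    - (a 0 * (c * T)) + T                            ≈⟨ +-cong (-‿cong a₀cT≈T) refl ⟩
    - T + T                                          ≈⟨ -‿inverseˡ _ ⟩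
    0#                                               ≈⟨ 𝟙-suc m ⟨
    𝟙 (suc m)                                        ∎
    where
    step : ℕ → (ℕ → Carrier) → Carrier
    step n h = - (c * Σ< (suc n) (λ j → a (suc j) * h (n ∸ j)))
    open CourseOfValues c step
    a⁻¹ = inverse c a
    T = Σ< (suc m) (λ j → a (suc j) * a⁻¹ (m ∸ j))
    T′ = Σ< (suc m) (λ j → a (suc j) * table m (m ∸ j))
    T≈T′ : T ≈ T′
    T≈T′ = Σ-cong (suc m) (λ j _ → *-cong refl (reflexive (≡.sym (table-cov m (m ∸ j) (ℕP.m∸n≤m m j)))))
    a₀cT≈T : a 0 * (c * T) ≈ T
    a₀cT≈T = trans (sym (*-assoc _ _ _)) (trans (*-cong (trans (*-comm _ _) ca) refl) (*-identityˡ T))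

-- ν n plays the role of the numeral n in R; D is then d/dx on coefficients.
module Derivation (R : CommutativeRing 0ℓ 0ℓ)
  (𝟙 : ℕ → CommutativeRing.Carrier R)
  (𝟙-zero : CommutativeRing._≈_ R (𝟙 0) (CommutativeRing.1# R))
  (𝟙-suc : ∀ n → CommutativeRing._≈_ R (𝟙 (suc n)) (CommutativeRing.0# R))
  (ν : ℕ → CommutativeRing.Carrier R)
  (ν-zero : CommutativeRing._≈_ R (ν 0) (CommutativeRing.0# R))
  (ν-+ : ∀ m n → CommutativeRing._≈_ R (ν (m ℕ.+ n)) (CommutativeRing._+_ R (ν m) (ν n))) where

  open CommutativeRing R
  open PowerSeries R 𝟙 𝟙-zero 𝟙-suc
  open import Relation.Binary.Reasoning.Setoid setoid
  open import Algebra.Properties.Ring ring using (-‿distribʳ-*)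

  D : Series → Series
  D f n = ν (suc n) * f (suc n)

  D-cong : ∀ {f g} → f ≋ g → D f ≋ D g
  D-cong p n = *-cong refl (p (suc n))

  D-⊕ : ∀ f g → D (f ⊕ g) ≋ D f ⊕ D g
  D-⊕ f g n = distribˡ _ _ _

  D-⊖ : ∀ f → D (⊖ f) ≋ ⊖ D f
  D-⊖ f n = sym (-‿distribʳ-* _ _)

  D-κ : ∀ a → D (κ a) ≋ 𝟘
  D-κ a n = zeroʳ _

  D-𝟙 : D 𝟙 ≋ 𝟘
  D-𝟙 n = trans (*-cong refl (𝟙-suc n)) (zeroʳ _)

  ν-split : ∀ n i → i ≤ n → ν n ≈ ν i + ν (n ∸ i)
  ν-split n i p = trans (reflexive (≡.cong ν (≡.sym (ℕP.m+[n∸m]≡n p)))) (ν-+ i (n ∸ i))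

  D-⊛ : ∀ f g → D (f ⊛ g) ≋ D f ⊛ g ⊕ f ⊛ D g
  D-⊛ f g n = begin
    ν (suc n) * Σ< (suc (suc n)) (λ i → f i * g (suc n ∸ i))   ≈⟨ *-Σ (suc (suc n)) _ _ ⟩
    Σ< (suc (suc n)) (λ i → ν (suc n) * (f i * g (suc n ∸ i)))
      ≈⟨ Σ-cong (suc (suc n)) (λ i p → trans (*-cong (ν-split (suc n) i (ℕP.≤-pred p)) refl) (distribʳ _ _ _)) ⟩
    Σ< (suc (suc n)) (λ i → A i + B i)                        ≈⟨ Σ-+ (suc (suc n)) A B ⟩
    Σ< (suc (suc n)) A + Σ< (suc (suc n)) B                   ≈⟨ +-cong ΣA ΣB ⟩
    (D f ⊛ g) n + (f ⊛ D g) n                                 ∎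
    where
    A B : ℕ → Carrier
    A i = ν i * (f i * g (suc n ∸ i))
    B i = ν (suc n ∸ i) * (f i * g (suc n ∸ i))
    ΣA : Σ< (suc (suc n)) A ≈ (D f ⊛ g) n
    ΣA = begin
      Σ< (suc (suc n)) A                     ≈⟨ Σ-head (suc n) A ⟩
      A 0 + Σ< (suc n) (λ i → A (suc i))     ≈⟨ +-cong (trans (*-cong ν-zero refl) (zeroˡ _)) refl ⟩
      0# + Σ< (suc n) (λ i → A (suc i))      ≈⟨ +-identityˡ _ ⟩
      Σ< (suc n) (λ i → A (suc i))           ≈⟨ Σ-cong′ (suc n) (λ i → sym (*-assoc _ _ _)) ⟩
      (D f ⊛ g) n                            ∎
    ΣB : Σ< (suc (suc n)) B ≈ (f ⊛ D g) n
    ΣB = begin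
      Σ< (suc n) B + B (suc n)
        ≈⟨ +-cong refl (trans (*-cong (trans (reflexive (≡.cong ν (ℕP.n∸n≡0 n))) ν-zero) refl) (zeroˡ _)) ⟩
      Σ< (suc n) B + 0#        ≈⟨ +-identityʳ _ ⟩
      Σ< (suc n) B             ≈⟨ Σ-cong (suc n) (λ i p → begin
          ν (suc n ∸ i) * (f i * g (suc n ∸ i))
            ≈⟨ reflexive (≡.cong (λ k → ν k * (f i * g k)) (ℕP.+-∸-assoc 1 (ℕP.≤-pred p))) ⟩
          ν (suc (n ∸ i)) * (f i * g (suc (n ∸ i)))
            ≈⟨ trans (sym (*-assoc _ _ _)) (trans (*-cong (*-comm _ _) refl) (*-assoc _ _ _)) ⟩
          f i * (ν (suc (n ∸ i)) * g (suc (n ∸ i))) ∎) ⟩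
      (f ⊛ D g) n              ∎

ℕtoℚ≡mkℚ : ∀ n → ℕtoℚ n ≡ mkℚ (+ n) 0 (Coprime.sym (Coprime.1-coprimeTo n))
ℕtoℚ≡mkℚ n = ℚP.normalize-coprime (Coprime.sym (Coprime.1-coprimeTo n))

ℕtoℚ-+ : ∀ m n → ℕtoℚ (m ℕ.+ n) ≡ ℕtoℚ m ℚ.+ ℕtoℚ n
ℕtoℚ-+ m n = ≡.trans
  (≡.cong (ℚ._/ 1) (≡.sym (≡.cong₂ ℤ._+_ (ℤP.*-identityʳ (+ m)) (ℤP.*-identityʳ (+ n)))))
  (≡.sym (≡.cong₂ ℚ._+_ (ℕtoℚ≡mkℚ m) (ℕtoℚ≡mkℚ n)))

ℕtoℚ-* : ∀ m n → ℕtoℚ (m ℕ.* n) ≡ ℕtoℚ m ℚ.* ℕtoℚ n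
ℕtoℚ-* m n = ≡.trans
  (≡.cong (ℚ._/ 1) (ℤP.pos-* m n))
  (≡.sym (≡.cong₂ ℚ._*_ (ℕtoℚ≡mkℚ m) (ℕtoℚ≡mkℚ n)))

ℕtoℚ-suc≢0 : ∀ n → ℕtoℚ (suc n) ≢ 0ℚ
ℕtoℚ-suc≢0 n e with ≡.trans (≡.sym (ℕtoℚ≡mkℚ (suc n))) e
... | ()

ℕtoℚ-!≢0 : ∀ n → ℕtoℚ (n !) ≢ 0ℚ
ℕtoℚ-!≢0 n with n ! | ℕP._!≢0 n
... | suc m | _ = ℕtoℚ-suc≢0 m

invℚ-inverseˡ : ∀ q → q ≢ 0ℚ → invℚ q ℚ.* q ≡ 1ℚ
invℚ-inverseˡ q q≢0 with q ℚP.≟ 0ℚ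
... | yes q≡0 = ⊥-elim (q≢0 q≡0)
... | no q≢0′ = ℚP.*-inverseˡ q {{ℚ.≢-nonZero q≢0′}}

invℚ-inverseʳ : ∀ q → q ≢ 0ℚ → q ℚ.* invℚ q ≡ 1ℚ
invℚ-inverseʳ q q≢0 = ≡.trans (ℚP.*-comm q _) (invℚ-inverseˡ q q≢0)

*-cancelˡ-zero : ∀ q x → q ≢ 0ℚ → q ℚ.* x ≡ 0ℚ → x ≡ 0ℚ
*-cancelˡ-zero q x q≢0 qx≡0 = begin
  x                         ≡⟨ ℚP.*-identityˡ x ⟨
  1ℚ ℚ.* x                  ≡⟨ ≡.cong (ℚ._* x) (invℚ-inverseˡ q q≢0) ⟨
  (invℚ q ℚ.* q) ℚ.* x      ≡⟨ ℚP.*-assoc (invℚ q) q x ⟩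
  invℚ q ℚ.* (q ℚ.* x)      ≡⟨ ≡.cong (invℚ q ℚ.*_) qx≡0 ⟩
  invℚ q ℚ.* 0ℚ             ≡⟨ ℚP.*-zeroʳ (invℚ q) ⟩
  0ℚ                        ∎
  where open ≡.≡-Reasoning

*-invℚ-* : ∀ a b → b ≢ 0ℚ → a ℚ.* b ≢ 0ℚ → a ℚ.* invℚ (a ℚ.* b) ≡ invℚ b
*-invℚ-* a b b≢0 ab≢0 = begin
  a ℚ.* u                          ≡⟨ ℚP.*-identityˡ _ ⟨
  1ℚ ℚ.* (a ℚ.* u)                 ≡⟨ ≡.cong (ℚ._* (a ℚ.* u)) (invℚ-inverseˡ b b≢0) ⟨
  (invℚ b ℚ.* b) ℚ.* (a ℚ.* u)     ≡⟨ ≡.cong (ℚ._* (a ℚ.* u)) (ℚP.*-comm (invℚ b) b) ⟩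
  (b ℚ.* invℚ b) ℚ.* (a ℚ.* u)     ≡⟨ regroup b (invℚ b) a u ⟩
  invℚ b ℚ.* ((a ℚ.* b) ℚ.* u)     ≡⟨ ≡.cong (invℚ b ℚ.*_) (invℚ-inverseʳ (a ℚ.* b) ab≢0) ⟩
  invℚ b ℚ.* 1ℚ                    ≡⟨ ℚP.*-identityʳ (invℚ b) ⟩
  invℚ b                           ∎
  where
  open ≡.≡-Reasoning
  open import Data.Rational.Solver using (module +-*-Solver)
  open +-*-Solver
  u = invℚ (a ℚ.* b)
  regroup : ∀ b i a u → (b ℚ.* i) ℚ.* (a ℚ.* u) ≡ i ℚ.* ((a ℚ.* b) ℚ.* u)
  regroup = solve 4 (λ b i a u → (b :* i) :* (a :* u) := i :* ((a :* b) :* u)) ≡.refl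

suc*invℚ[suc!]≡invℚ[!] : ∀ n → ℕtoℚ (suc n) ℚ.* invℚ (ℕtoℚ (suc n !)) ≡ invℚ (ℕtoℚ (n !))
suc*invℚ[suc!]≡invℚ[!] n =
  ≡.trans (≡.cong (λ z → ℕtoℚ (suc n) ℚ.* invℚ z) (ℕtoℚ-* (suc n) (n !)))
    (*-invℚ-* (ℕtoℚ (suc n)) (ℕtoℚ (n !)) (ℕtoℚ-!≢0 n)
       (λ e → ℕtoℚ-!≢0 (suc n) (≡.trans (ℕtoℚ-* (suc n) (n !)) e)))

ℚ-ring : CommutativeRing 0ℓ 0ℓ
ℚ-ring = ℚP.+-*-commutativeRing

module SPS = PowerSeries ℚ-ring 1S ≡.refl (λ _ → ≡.refl)

S-ring : CommutativeRing 0ℓ 0ℓ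
S-ring = SPS.powerSeriesRing

module SR = CommutativeRing S-ring

numeral : ℕ → S
numeral k = SPS.κ (ℕtoℚ k)

numeral-zero : numeral 0 ≐ 0S
numeral-zero zero = ≡.refl
numeral-zero (suc m) = ≡.refl

numeral-+ : ∀ m n → numeral (m ℕ.+ n) ≐ numeral m +S numeral n
numeral-+ m n zero = ℕtoℚ-+ m n
numeral-+ m n (suc k) = ≡.refl

module XPS = PowerSeries S-ring (constX 1S) (λ _ → ≡.refl) (λ _ _ → ≡.refl)
module XD = Derivation S-ring (constX 1S) (λ _ → ≡.refl) (λ _ _ → ≡.refl) numeral numeral-zero numeral-+

X-ring : CommutativeRing 0ℓ 0ℓ
X-ring = XPS.powerSeriesRing

module XR = CommutativeRing X-ring

open SR using () renaming (_+_ to _+ₛ_; _*_ to _*ₛ_; _≈_ to _≈ₛ_; -_ to -ₛ_)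
open XR using () renaming (_+_ to _⊕_; _*_ to _⊛_; -_ to ⊖_; _-_ to _⊝_; _≈_ to _≋_; 1# to 𝟏; 0# to 𝟎)
open XD using (D)

κ-*-homo : ∀ p q → SPS.κ p SPS.⊛ SPS.κ q ≐ SPS.κ (p ℚ.* q)
κ-*-homo p q zero = SPS.κ-⊛ p (SPS.κ q) zero
κ-*-homo p q (suc m) = ≡.trans (SPS.κ-⊛ p (SPS.κ q) (suc m)) (ℚP.*-zeroʳ p)

scaleS≐κ-⊛ : ∀ q f → scaleS q f ≐ SPS.κ q SPS.⊛ f
scaleS≐κ-⊛ q f m = ≡.sym (SPS.κ-⊛ q f m)

module SolverS where

  κ-+-homo : ∀ p q → SPS.κ (p ℚ.+ q) SPS.≋ SPS.κ p SPS.⊕ SPS.κ q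
  κ-+-homo p q zero = ≡.refl
  κ-+-homo p q (suc m) = ≡.refl

  κ-neg-homo : ∀ p → SPS.κ (ℚ.- p) SPS.≋ SPS.⊖ SPS.κ p
  κ-neg-homo p zero = ≡.refl
  κ-neg-homo p (suc m) = ≡.refl

  κ-0-homo : SPS.κ 0ℚ SPS.≋ SPS.𝟘
  κ-0-homo zero = ≡.refl
  κ-0-homo (suc m) = ≡.refl

  κ-1-homo : SPS.κ 1ℚ SPS.≋ 1S
  κ-1-homo zero = ≡.refl
  κ-1-homo (suc m) = ≡.refl

  κ-homomorphism : ACR._-Raw-AlmostCommutative⟶_ (CommutativeRing.rawRing ℚ-ring)
                                                 (ACR.fromCommutativeRing S-ring)
  κ-homomorphism = record
    { ⟦_⟧ = SPS.κ
    ; +-homo = κ-+-homo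
    ; *-homo = λ p q → SR.sym (κ-*-homo p q)
    ; -‿homo = κ-neg-homo
    ; 0-homo = κ-0-homo
    ; 1-homo = κ-1-homo
    }

  κ-≟ : ∀ p q → Maybe (SPS.κ p SPS.≋ SPS.κ q)
  κ-≟ p q with p ℚP.≟ q
  ... | yes ≡.refl = just (λ m → ≡.refl)
  ... | no _ = nothing

  open RingSolver (CommutativeRing.rawRing ℚ-ring) (ACR.fromCommutativeRing S-ring) κ-homomorphism κ-≟ public

ℚ→X : ℚ → X
ℚ→X q = XPS.κ (SPS.κ q)

module SolverX where

  ℚ→X-+-homo : ∀ p q → ℚ→X (p ℚ.+ q) XPS.≋ ℚ→X p XPS.⊕ ℚ→X q
  ℚ→X-+-homo p q zero zero = ≡.refl
  ℚ→X-+-homo p q zero (suc m) = ≡.refl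
  ℚ→X-+-homo p q (suc n) m = ≡.refl

  ℚ→X-*-homo : ∀ p q → ℚ→X (p ℚ.* q) XPS.≋ ℚ→X p XPS.⊛ ℚ→X q
  ℚ→X-*-homo p q n m = ≡.sym (≡.trans (XPS.κ-⊛ (SPS.κ p) (ℚ→X q) n m) (coefficient n m))
    where
    coefficient : ∀ n m → (SPS.κ p SPS.⊛ ℚ→X q n) m ≡ ℚ→X (p ℚ.* q) n m
    coefficient zero m = κ-*-homo p q m
    coefficient (suc n) m = SR.zeroʳ (SPS.κ p) m

  ℚ→X-neg-homo : ∀ p → ℚ→X (ℚ.- p) XPS.≋ XPS.⊖ ℚ→X p
  ℚ→X-neg-homo p zero zero = ≡.refl
  ℚ→X-neg-homo p zero (suc m) = ≡.refl
  ℚ→X-neg-homo p (suc n) m = ≡.refl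

  ℚ→X-0-homo : ℚ→X 0ℚ XPS.≋ XPS.𝟘
  ℚ→X-0-homo zero zero = ≡.refl
  ℚ→X-0-homo zero (suc m) = ≡.refl
  ℚ→X-0-homo (suc n) m = ≡.refl

  ℚ→X-1-homo : ℚ→X 1ℚ XPS.≋ constX 1S
  ℚ→X-1-homo zero zero = ≡.refl
  ℚ→X-1-homo zero (suc m) = ≡.refl
  ℚ→X-1-homo (suc n) m = ≡.refl

  ℚ→X-homomorphism : ACR._-Raw-AlmostCommutative⟶_ (CommutativeRing.rawRing ℚ-ring)
                                                   (ACR.fromCommutativeRing X-ring)
  ℚ→X-homomorphism = record
    { ⟦_⟧ = ℚ→X
    ; +-homo = ℚ→X-+-homo
    ; *-homo = ℚ→X-*-homo
    ; -‿homo = ℚ→X-neg-homo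
    ; 0-homo = ℚ→X-0-homo
    ; 1-homo = ℚ→X-1-homo
    }

  ℚ→X-≟ : ∀ p q → Maybe (ℚ→X p XPS.≋ ℚ→X q)
  ℚ→X-≟ p q with p ℚP.≟ q
  ... | yes ≡.refl = just (λ n m → ≡.refl)
  ... | no _ = nothing

  open RingSolver (CommutativeRing.rawRing ℚ-ring) (ACR.fromCommutativeRing X-ring) ℚ→X-homomorphism ℚ→X-≟ public

constX≋κ : ∀ s → constX s ≋ XPS.κ s
constX≋κ s zero m = ≡.refl
constX≋κ s (suc n) m = ≡.refl

D-constX : ∀ s → D (constX s) ≋ 𝟎
D-constX s = XR.trans (XD.D-cong (constX≋κ s)) (XD.D-κ s)

D-constX-⊛ : ∀ s f → D (constX s ⊛ f) ≋ constX s ⊛ D f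
D-constX-⊛ s f = begin
  D (constX s ⊛ f)                   ≈⟨ XD.D-⊛ (constX s) f ⟩
  D (constX s) ⊛ f ⊕ constX s ⊛ D f  ≈⟨ XR.+-cong (XR.*-cong (D-constX s) (XR.refl {f})) (XR.refl {constX s ⊛ D f}) ⟩
  𝟎 ⊛ f ⊕ constX s ⊛ D f             ≈⟨ XR.+-cong (XR.zeroˡ f) (XR.refl {constX s ⊛ D f}) ⟩
  𝟎 ⊕ constX s ⊛ D f                 ≈⟨ XR.+-identityˡ _ ⟩
  constX s ⊛ D f                     ∎
  where open import Relation.Binary.Reasoning.Setoid XR.setoid

-- The factor n + 1 brought down by D cancels against (n + 1)! in e^{sx}.
D-expX : ∀ s → D (expX s) ≋ constX s ⊛ expX s
D-expX s n =
  SR.trans coefficient (SR.sym (SR.trans (XR.*-cong (constX≋κ s) (XR.refl {expX s}) n) (XPS.κ-⊛ s (expX s) n)))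
  where
  open import Relation.Binary.Reasoning.Setoid SR.setoid
  sⁿ⁺¹ = s SPS.⊛ powS s n
  q₁ = ℕtoℚ (suc n)
  q₂ = invℚ (ℕtoℚ (suc n !))
  q₃ = invℚ (ℕtoℚ (n !))
  coefficient : numeral (suc n) SPS.⊛ expX s (suc n) SPS.≋ s SPS.⊛ expX s n
  coefficient = begin
    SPS.κ q₁ SPS.⊛ scaleS q₂ sⁿ⁺¹               ≈⟨ SR.*-cong (SR.refl {SPS.κ q₁}) (scaleS≐κ-⊛ q₂ sⁿ⁺¹) ⟩
    SPS.κ q₁ SPS.⊛ (SPS.κ q₂ SPS.⊛ sⁿ⁺¹)        ≈⟨ SR.*-assoc (SPS.κ q₁) (SPS.κ q₂) sⁿ⁺¹ ⟨
    (SPS.κ q₁ SPS.⊛ SPS.κ q₂) SPS.⊛ sⁿ⁺¹        ≈⟨ SR.*-cong {SPS.κ q₁ SPS.⊛ SPS.κ q₂} {SPS.κ q₃} {sⁿ⁺¹}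
                                                     (λ m → ≡.trans (κ-*-homo q₁ q₂ m)
                                                              (≡.cong (λ z → SPS.κ z m) (suc*invℚ[suc!]≡invℚ[!] n)))
                                                     (SR.refl {sⁿ⁺¹}) ⟩
    SPS.κ q₃ SPS.⊛ (s SPS.⊛ powS s n)           ≈⟨ SR.*-cong (SR.refl {SPS.κ q₃}) (SR.*-comm s (powS s n)) ⟩
    SPS.κ q₃ SPS.⊛ (powS s n SPS.⊛ s)           ≈⟨ SR.*-assoc (SPS.κ q₃) (powS s n) s ⟨
    (SPS.κ q₃ SPS.⊛ powS s n) SPS.⊛ s           ≈⟨ SR.*-comm (SPS.κ q₃ SPS.⊛ powS s n) s ⟩
    s SPS.⊛ (SPS.κ q₃ SPS.⊛ powS s n)           ≈⟨ SR.*-cong (SR.refl {s}) (SR.sym (scaleS≐κ-⊛ q₃ (powS s n))) ⟩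
    s SPS.⊛ expX s n                            ∎

expX-zero : ∀ s → expX s 0 SPS.≋ 1S
expX-zero s zero = ≡.refl
expX-zero s (suc m) = ≡.refl

expX-one : ∀ s → expX s 1 SPS.≋ s
expX-one s = SR.trans (λ m → ℚP.*-identityˡ ((s SPS.⊛ 1S) m)) (SR.*-identityʳ s)

-- The unit as the ring solver denotes it (con 1ℚ).
𝟏′ : X
𝟏′ = ℚ→X 1ℚ

𝟏′≋𝟏 : 𝟏′ ≋ 𝟏
𝟏′≋𝟏 = SolverX.ℚ→X-1-homo

⊛𝟏′ : ∀ f → f ≋ f ⊛ 𝟏′
⊛𝟏′ f = XR.trans (XR.sym (XR.*-identityʳ f)) (XR.*-cong (XR.refl {f}) (XR.sym 𝟏′≋𝟏))

eˣ eʸˣ e⁽ʸ⁻¹⁾ˣ yX y-1X : X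
eˣ = expX 1S
eʸˣ = expX yS
e⁽ʸ⁻¹⁾ˣ = expX (yS -S 1S)
yX = constX yS
y-1X = constX (yS -S 1S)

y-1X≋yX⊝𝟏′ : y-1X ≋ yX ⊝ 𝟏′
y-1X≋yX⊝𝟏′ zero zero = ≡.refl
y-1X≋yX⊝𝟏′ zero (suc m) = ≡.refl
y-1X≋yX⊝𝟏′ (suc n) m = ≡.refl

D-eˣ : D eˣ ≋ eˣ
D-eˣ = XR.trans (D-expX 1S) (XR.*-identityˡ eˣ)

D-eʸˣ : D eʸˣ ≋ yX ⊛ eʸˣ
D-eʸˣ = D-expX yS

D-e⁽ʸ⁻¹⁾ˣ : D e⁽ʸ⁻¹⁾ˣ ≋ y-1X ⊛ e⁽ʸ⁻¹⁾ˣ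
D-e⁽ʸ⁻¹⁾ˣ = D-expX (yS -S 1S)

-- Fgf = numF / denF and Ggf = y-1X ⊛ eʸˣ / denG.
numF denF denG : X
numF = eˣ ⊝ eʸˣ
denF = eʸˣ ⊝ yX ⊛ eˣ
denG = yX ⊝ e⁽ʸ⁻¹⁾ˣ

denF⁻¹ denG⁻¹ : X
denF⁻¹ = invX denF
denG⁻¹ = invX denG

⊛-invS : ∀ s → invℚ (s 0) ℚ.* s 0 ≡ 1ℚ → s SPS.⊛ invS s SPS.≋ 1S
⊛-invS s = SPS.⊛-inverse (invℚ (s 0)) s

⊛-invX : ∀ u → u 0 SPS.⊛ invS (u 0) SPS.≋ 1S → u ⊛ invX u ≋ 𝟏
⊛-invX u h = XPS.⊛-inverse (invS (u 0)) u (SR.trans (SR.*-comm (invS (u 0)) (u 0)) h)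

denF⊛denF⁻¹ : denF ⊛ denF⁻¹ ≋ 𝟏
denF⊛denF⁻¹ = ⊛-invX denF (⊛-invS (denF 0) ≡.refl)

denG⊛denG⁻¹ : denG ⊛ denG⁻¹ ≋ 𝟏
denG⊛denG⁻¹ = ⊛-invX denG (⊛-invS (denG 0) ≡.refl)

𝟏′≋denF⊛denF⁻¹ : 𝟏′ ≋ denF ⊛ denF⁻¹
𝟏′≋denF⊛denF⁻¹ = XR.trans 𝟏′≋𝟏 (XR.sym denF⊛denF⁻¹)

𝟏′≋denG⊛denG⁻¹ : 𝟏′ ≋ denG ⊛ denG⁻¹
𝟏′≋denG⊛denG⁻¹ = XR.trans 𝟏′≋𝟏 (XR.sym denG⊛denG⁻¹)

-- Differentiate u ⊛ i ≋ 𝟏 by the Leibniz rule and solve for D i.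
D-inverse : ∀ u i → u ⊛ i ≋ 𝟏 → D i ≋ ⊖ (D u ⊛ i ⊛ i)
D-inverse u i u⊛i≋𝟏 = begin
  D i                                                                  ≈⟨ expand u i (D i) (D u) ⟩
  ⊖ (D u ⊛ i ⊛ i) ⊕ (D i ⊛ (𝟏′ ⊝ u ⊛ i) ⊕ i ⊛ (D u ⊛ i ⊕ u ⊛ D i))
    ≈⟨ XR.+-cong (XR.refl {⊖ (D u ⊛ i ⊛ i)})
                 (XR.+-cong (XR.*-cong (XR.refl {D i}) 𝟏′⊝u⊛i≋𝟎) (XR.*-cong (XR.refl {i}) D[u⊛i]≋𝟎)) ⟩
  ⊖ (D u ⊛ i ⊛ i) ⊕ (D i ⊛ 𝟎 ⊕ i ⊛ 𝟎)
    ≈⟨ XR.+-cong (XR.refl {⊖ (D u ⊛ i ⊛ i)})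
                 (XR.trans (XR.+-cong (XR.zeroʳ (D i)) (XR.zeroʳ i)) (XR.+-identityˡ 𝟎)) ⟩
  ⊖ (D u ⊛ i ⊛ i) ⊕ 𝟎                                                  ≈⟨ XR.+-identityʳ _ ⟩
  ⊖ (D u ⊛ i ⊛ i)                                                      ∎
  where
  open import Relation.Binary.Reasoning.Setoid XR.setoid
  open SolverX
  expand : ∀ u i di du → di ≋ ⊖ (du ⊛ i ⊛ i) ⊕ (di ⊛ (𝟏′ ⊝ u ⊛ i) ⊕ i ⊛ (du ⊛ i ⊕ u ⊛ di))
  expand = solve 4 (λ u i di du →
    di := (:- (du :* i :* i)) :+ (di :* (con 1ℚ :- u :* i) :+ i :* (du :* i :+ u :* di))) XR.refl
  𝟏′⊝u⊛i≋𝟎 : 𝟏′ ⊝ u ⊛ i ≋ 𝟎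
  𝟏′⊝u⊛i≋𝟎 = XR.trans (XR.+-cong 𝟏′≋𝟏 (XR.-‿cong u⊛i≋𝟏)) (XR.-‿inverseʳ 𝟏)
  D[u⊛i]≋𝟎 : D u ⊛ i ⊕ u ⊛ D i ≋ 𝟎
  D[u⊛i]≋𝟎 = XR.trans (XR.sym (XD.D-⊛ u i)) (XR.trans (XD.D-cong u⊛i≋𝟏) XD.D-𝟙)

-- Comparing coefficients in D u = s u gives (n + 1) uₙ₊₁ = s uₙ.
ode-zero : ∀ s u → D u ≋ constX s ⊛ u → u 0 SPS.≋ SPS.𝟘 → ∀ n → u n SPS.≋ SPS.𝟘
ode-zero s u Du≋su u₀≋0 zero = u₀≋0
ode-zero s u Du≋su u₀≋0 (suc n) m = *-cancelˡ-zero (ℕtoℚ (suc n)) (u (suc n) m) (ℕtoℚ-suc≢0 n) (begin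
  ℕtoℚ (suc n) ℚ.* u (suc n) m    ≡⟨ SPS.κ-⊛ (ℕtoℚ (suc n)) (u (suc n)) m ⟨
  D u n m                         ≡⟨ Du≋su n m ⟩
  (constX s ⊛ u) n m              ≡⟨ XR.*-cong (constX≋κ s) (XR.refl {u}) n m ⟩
  (XPS.κ s ⊛ u) n m               ≡⟨ XPS.κ-⊛ s u n m ⟩
  (s SPS.⊛ u n) m                 ≡⟨ SR.*-cong (SR.refl {s}) (ode-zero s u Du≋su u₀≋0 n) m ⟩
  (s SPS.⊛ SPS.𝟘) m               ≡⟨ SR.zeroʳ s m ⟩
  0ℚ                              ∎)
  where open ≡.≡-Reasoning

module _ where
  open import Relation.Binary.Reasoning.Setoid XR.setoid

  -- The difference of the two sides solves D u = y u with u₀ = 0.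
  e⁽ʸ⁻¹⁾ˣ⊛eˣ≋eʸˣ : e⁽ʸ⁻¹⁾ˣ ⊛ eˣ ≋ eʸˣ
  e⁽ʸ⁻¹⁾ˣ⊛eˣ≋eʸˣ = begin
    c ⊛ a                   ≈⟨ XR.+-identityʳ (c ⊛ a) ⟨
    c ⊛ a ⊕ 𝟎               ≈⟨ XR.+-cong (XR.refl {c ⊛ a}) (XR.-‿inverseˡ b) ⟨
    c ⊛ a ⊕ (⊖ b ⊕ b)       ≈⟨ XR.+-assoc (c ⊛ a) (⊖ b) b ⟨
    u ⊕ b                   ≈⟨ XR.+-cong {u} {𝟎} {b} {b} (ode-zero yS u D-u u₀≋𝟎) (XR.refl {b}) ⟩
    𝟎 ⊕ b                   ≈⟨ XR.+-identityˡ b ⟩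
    b                       ∎
    where
    a = eˣ
    b = eʸˣ
    c = e⁽ʸ⁻¹⁾ˣ
    u = c ⊛ a ⊝ b
    open SolverX
    collect : ∀ Y c a b → ((Y ⊝ 𝟏′) ⊛ c ⊛ a ⊕ c ⊛ a) ⊕ ⊖ (Y ⊛ b) ≋ Y ⊛ (c ⊛ a ⊝ b)
    collect = solve 4 (λ Y c a b → ((Y :- con 1ℚ) :* c :* a :+ c :* a) :+ (:- (Y :* b)) := Y :* (c :* a :- b)) XR.refl
    D-u : D u ≋ yX ⊛ u
    D-u = begin
      D u                                     ≈⟨ XD.D-⊕ (c ⊛ a) (⊖ b) ⟩
      D (c ⊛ a) ⊕ D (⊖ b)                     ≈⟨ XR.+-cong (XD.D-⊛ c a) (XD.D-⊖ b) ⟩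
      (D c ⊛ a ⊕ c ⊛ D a) ⊕ ⊖ D b
        ≈⟨ XR.+-cong (XR.+-cong (XR.*-cong (XR.trans D-e⁽ʸ⁻¹⁾ˣ (XR.*-cong y-1X≋yX⊝𝟏′ (XR.refl {c}))) (XR.refl {a}))
                                (XR.*-cong (XR.refl {c}) D-eˣ))
                     (XR.-‿cong D-eʸˣ) ⟩
      ((yX ⊝ 𝟏′) ⊛ c ⊛ a ⊕ c ⊛ a) ⊕ ⊖ (yX ⊛ b) ≈⟨ collect yX c a b ⟩
      yX ⊛ u                                  ∎
    c₀a₀≋1 : (c ⊛ a) 0 SPS.≋ 1S
    c₀a₀≋1 = SR.trans (SR.+-identityˡ (c 0 SPS.⊛ a 0))
               (SR.trans (SR.*-cong (expX-zero (yS -S 1S)) (expX-zero 1S)) (SR.*-identityˡ 1S))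
    u₀≋𝟎 : u 0 SPS.≋ SPS.𝟘
    u₀≋𝟎 = SR.trans (SR.+-cong c₀a₀≋1 (SR.-‿cong (expX-zero yS))) (SR.-‿inverseʳ 1S)

  D-denF⁻¹ : D denF⁻¹ ≋ ⊖ ((yX ⊛ eʸˣ ⊝ yX ⊛ eˣ) ⊛ denF⁻¹ ⊛ denF⁻¹)
  D-denF⁻¹ = XR.trans (D-inverse denF denF⁻¹ denF⊛denF⁻¹)
    (XR.-‿cong (XR.*-cong (XR.*-cong D-denF (XR.refl {denF⁻¹})) (XR.refl {denF⁻¹})))
    where
    D-denF : D denF ≋ yX ⊛ eʸˣ ⊝ yX ⊛ eˣ
    D-denF = XR.trans (XD.D-⊕ eʸˣ (⊖ (yX ⊛ eˣ)))
      (XR.+-cong D-eʸˣ (XR.trans (XD.D-⊖ (yX ⊛ eˣ))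
        (XR.-‿cong (XR.trans (D-constX-⊛ yS eˣ) (XR.*-cong (XR.refl {yX}) D-eˣ)))))

  D-Fgf : D Fgf ≋ (𝟏′ ⊕ Fgf) ⊛ (𝟏′ ⊕ yX ⊛ Fgf)
  D-Fgf = begin
    D (numF ⊛ I)                       ≈⟨ XD.D-⊛ numF I ⟩
    D numF ⊛ I ⊕ numF ⊛ D I            ≈⟨ XR.+-cong (XR.*-cong D-numF (XR.refl {I})) (XR.*-cong (XR.refl {numF}) D-denF⁻¹) ⟩
    (a ⊝ Y ⊛ b) ⊛ I ⊕ numF ⊛ DI        ≈⟨ XR.+-cong (XR.trans (⊛𝟏′ ((a ⊝ Y ⊛ b) ⊛ I))
                                                       (XR.*-cong (XR.refl {(a ⊝ Y ⊛ b) ⊛ I}) 𝟏′≋denF⊛denF⁻¹))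
                                                   (XR.refl {numF ⊛ DI}) ⟩
    (a ⊝ Y ⊛ b) ⊛ I ⊛ (denF ⊛ I) ⊕ numF ⊛ DI
                                       ≈⟨ regroup a b Y I ⟩
    (denF ⊛ I ⊕ Fgf) ⊛ (denF ⊛ I ⊕ Y ⊛ Fgf)
                                       ≈⟨ XR.*-cong (XR.+-cong 𝟏′≋denF⊛denF⁻¹ (XR.refl {Fgf}))
                                                    (XR.+-cong 𝟏′≋denF⊛denF⁻¹ (XR.refl {Y ⊛ Fgf})) ⟨
    (𝟏′ ⊕ Fgf) ⊛ (𝟏′ ⊕ Y ⊛ Fgf)        ∎
    where
    a = eˣ
    b = eʸˣ
    Y = yX
    I = denF⁻¹
    DI = ⊖ ((Y ⊛ b ⊝ Y ⊛ a) ⊛ I ⊛ I)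
    D-numF : D numF ≋ a ⊝ Y ⊛ b
    D-numF = XR.trans (XD.D-⊕ a (⊖ b)) (XR.+-cong D-eˣ (XR.trans (XD.D-⊖ b) (XR.-‿cong D-eʸˣ)))
    open SolverX
    regroup : ∀ a b Y I →
      (a ⊝ Y ⊛ b) ⊛ I ⊛ ((b ⊝ Y ⊛ a) ⊛ I) ⊕ (a ⊝ b) ⊛ ⊖ ((Y ⊛ b ⊝ Y ⊛ a) ⊛ I ⊛ I)
        ≋ ((b ⊝ Y ⊛ a) ⊛ I ⊕ (a ⊝ b) ⊛ I) ⊛ ((b ⊝ Y ⊛ a) ⊛ I ⊕ Y ⊛ ((a ⊝ b) ⊛ I))
    regroup = solve 4 (λ a b Y I →
      (a :- Y :* b) :* I :* ((b :- Y :* a) :* I) :+ (a :- b) :* (:- ((Y :* b :- Y :* a) :* I :* I))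
        := ((b :- Y :* a) :* I :+ (a :- b) :* I) :* ((b :- Y :* a) :* I :+ Y :* ((a :- b) :* I))) XR.refl

  -- (y - 1) e^{(y-1)x} / (y - e^{(y-1)x}) = 1 + y F, using e^{(y-1)x} eˣ = e^{yx}.
  y-1X⊛e⁽ʸ⁻¹⁾ˣ⊛denG⁻¹≋𝟏′⊕yX⊛Fgf : y-1X ⊛ e⁽ʸ⁻¹⁾ˣ ⊛ denG⁻¹ ≋ 𝟏′ ⊕ yX ⊛ Fgf
  y-1X⊛e⁽ʸ⁻¹⁾ˣ⊛denG⁻¹≋𝟏′⊕yX⊛Fgf = begin
    y-1X ⊛ c ⊛ J                        ≈⟨ XR.*-cong (XR.*-cong y-1X≋yX⊝𝟏′ (XR.refl {c})) (XR.refl {J}) ⟩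
    (Y ⊝ 𝟏′) ⊛ c ⊛ J                    ≈⟨ ⊛𝟏′ _ ⟩
    (Y ⊝ 𝟏′) ⊛ c ⊛ J ⊛ 𝟏′               ≈⟨ XR.*-cong (XR.refl {(Y ⊝ 𝟏′) ⊛ c ⊛ J}) 𝟏′≋denF⊛denF⁻¹ ⟩
    (Y ⊝ 𝟏′) ⊛ c ⊛ J ⊛ ((b ⊝ Y ⊛ a) ⊛ I)  ≈⟨ expand Y c a b I J ⟩
    (Y ⊝ 𝟏′) ⊛ (c ⊛ b ⊝ Y ⊛ (c ⊛ a)) ⊛ J ⊛ I
      ≈⟨ XR.*-cong (XR.*-cong (XR.*-cong (XR.refl {Y ⊝ 𝟏′})
                                         (XR.+-cong (XR.refl {c ⊛ b}) (XR.-‿cong (XR.*-cong (XR.refl {Y}) e⁽ʸ⁻¹⁾ˣ⊛eˣ≋eʸˣ))))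
                              (XR.refl {J}))
                   (XR.refl {I}) ⟩
    (Y ⊝ 𝟏′) ⊛ (c ⊛ b ⊝ Y ⊛ b) ⊛ J ⊛ I    ≈⟨ factor Y c a b I J ⟩
    ((Y ⊝ c) ⊛ J) ⊛ ((b ⊝ Y ⊛ a) ⊛ I) ⊕ Y ⊛ ((a ⊝ b) ⊛ I) ⊛ ((Y ⊝ c) ⊛ J)
      ≈⟨ XR.+-cong (XR.*-cong 𝟏′≋denG⊛denG⁻¹ 𝟏′≋denF⊛denF⁻¹) (XR.*-cong (XR.refl {Y ⊛ Fgf}) 𝟏′≋denG⊛denG⁻¹) ⟨
    𝟏′ ⊛ 𝟏′ ⊕ Y ⊛ Fgf ⊛ 𝟏′                ≈⟨ unit (Y ⊛ Fgf) ⟩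
    𝟏′ ⊕ Y ⊛ Fgf                         ∎
    where
    a = eˣ
    b = eʸˣ
    c = e⁽ʸ⁻¹⁾ˣ
    Y = yX
    I = denF⁻¹
    J = denG⁻¹
    open SolverX
    expand : ∀ Y c a b I J → (Y ⊝ 𝟏′) ⊛ c ⊛ J ⊛ ((b ⊝ Y ⊛ a) ⊛ I) ≋ (Y ⊝ 𝟏′) ⊛ (c ⊛ b ⊝ Y ⊛ (c ⊛ a)) ⊛ J ⊛ I
    expand = solve 6 (λ Y c a b I J →
      (Y :- con 1ℚ) :* c :* J :* ((b :- Y :* a) :* I) := (Y :- con 1ℚ) :* (c :* b :- Y :* (c :* a)) :* J :* I) XR.refl
    factor : ∀ Y c a b I J → (Y ⊝ 𝟏′) ⊛ (c ⊛ b ⊝ Y ⊛ b) ⊛ J ⊛ I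
                             ≋ ((Y ⊝ c) ⊛ J) ⊛ ((b ⊝ Y ⊛ a) ⊛ I) ⊕ Y ⊛ ((a ⊝ b) ⊛ I) ⊛ ((Y ⊝ c) ⊛ J)
    factor = solve 6 (λ Y c a b I J →
      (Y :- con 1ℚ) :* (c :* b :- Y :* b) :* J :* I
        := ((Y :- c) :* J) :* ((b :- Y :* a) :* I) :+ Y :* ((a :- b) :* I) :* ((Y :- c) :* J)) XR.refl
    unit : ∀ Z → 𝟏′ ⊛ 𝟏′ ⊕ Z ⊛ 𝟏′ ≋ 𝟏′ ⊕ Z
    unit = solve 1 (λ Z → con 1ℚ :* con 1ℚ :+ Z :* con 1ℚ := con 1ℚ :+ Z) XR.refl

  D-Ggf : D Ggf ≋ Ggf ⊛ (𝟏′ ⊕ yX ⊕ yX ⊛ Fgf)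
  D-Ggf = begin
    D (Y1 ⊛ b ⊛ J)                                  ≈⟨ XD.D-⊛ (Y1 ⊛ b) J ⟩
    D (Y1 ⊛ b) ⊛ J ⊕ (Y1 ⊛ b) ⊛ D J
      ≈⟨ XR.+-cong (XR.*-cong (XR.trans (D-constX-⊛ (yS -S 1S) b) (XR.*-cong (XR.refl {Y1}) D-eʸˣ)) (XR.refl {J}))
                   (XR.*-cong (XR.refl {Y1 ⊛ b}) D-denG⁻¹) ⟩
    Y1 ⊛ (Y ⊛ b) ⊛ J ⊕ Y1 ⊛ b ⊛ ⊖ (⊖ (Y1 ⊛ c) ⊛ J ⊛ J) ≈⟨ collect Y1 Y b c J ⟩
    Ggf ⊛ (Y ⊕ Y1 ⊛ c ⊛ J)                          ≈⟨ XR.*-cong (XR.refl {Ggf}) (XR.+-cong (XR.refl {Y}) y-1X⊛e⁽ʸ⁻¹⁾ˣ⊛denG⁻¹≋𝟏′⊕yX⊛Fgf) ⟩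
    Ggf ⊛ (Y ⊕ (𝟏′ ⊕ Y ⊛ Fgf))                     ≈⟨ reassociate Ggf Y (Y ⊛ Fgf) ⟩
    Ggf ⊛ (𝟏′ ⊕ Y ⊕ Y ⊛ Fgf)                       ∎
    where
    b = eʸˣ
    c = e⁽ʸ⁻¹⁾ˣ
    Y = yX
    Y1 = y-1X
    J = denG⁻¹
    D-denG⁻¹ : D J ≋ ⊖ (⊖ (Y1 ⊛ c) ⊛ J ⊛ J)
    D-denG⁻¹ = XR.trans (D-inverse denG J denG⊛denG⁻¹) (XR.-‿cong (XR.*-cong (XR.*-cong D-denG (XR.refl {J})) (XR.refl {J})))
      where
      D-denG : D denG ≋ ⊖ (Y1 ⊛ c)
      D-denG = begin
        D denG             ≈⟨ XD.D-⊕ Y (⊖ c) ⟩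
        D Y ⊕ D (⊖ c)      ≈⟨ XR.+-cong (D-constX yS) (XR.trans (XD.D-⊖ c) (XR.-‿cong D-e⁽ʸ⁻¹⁾ˣ)) ⟩
        𝟎 ⊕ ⊖ (Y1 ⊛ c)     ≈⟨ XR.+-identityˡ _ ⟩
        ⊖ (Y1 ⊛ c)         ∎
    open SolverX
    collect : ∀ Y1 Y b c J → Y1 ⊛ (Y ⊛ b) ⊛ J ⊕ Y1 ⊛ b ⊛ ⊖ (⊖ (Y1 ⊛ c) ⊛ J ⊛ J) ≋ Y1 ⊛ b ⊛ J ⊛ (Y ⊕ Y1 ⊛ c ⊛ J)
    collect = solve 5 (λ Y1 Y b c J →
      Y1 :* (Y :* b) :* J :+ Y1 :* b :* (:- ((:- (Y1 :* c)) :* J :* J)) := Y1 :* b :* J :* (Y :+ Y1 :* c :* J)) XR.refl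
    reassociate : ∀ G Y Z → G ⊛ (Y ⊕ (𝟏′ ⊕ Z)) ≋ G ⊛ (𝟏′ ⊕ Y ⊕ Z)
    reassociate = solve 3 (λ G Y Z → G :* (Y :+ (con 1ℚ :+ Z)) := G :* (con 1ℚ :+ Y :+ Z)) XR.refl

  numeralX : ℕ → X
  numeralX k = ℚ→X (ℕtoℚ k)

  numeralX-zero : numeralX 0 ≋ 𝟎
  numeralX-zero = SolverX.ℚ→X-0-homo

  numeralX-suc : ∀ k → numeralX (suc k) ≋ 𝟏′ ⊕ numeralX k
  numeralX-suc k n m =
    ≡.trans (≡.cong (λ q → ℚ→X q n m) (ℕtoℚ-+ 1 k)) (SolverX.ℚ→X-+-homo (ℕtoℚ 1) (ℕtoℚ k) n m)

  D-powX-suc : ∀ f k → D (powX f (suc k)) ≋ numeralX (suc k) ⊛ powX f k ⊛ D f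
  D-powX-suc f zero = begin
    D (f ⊛ 𝟏)             ≈⟨ XD.D-cong (XR.*-identityʳ f) ⟩
    D f                   ≈⟨ XR.*-identityˡ (D f) ⟨
    𝟏 ⊛ D f               ≈⟨ XR.*-cong (XR.trans (XR.sym (XR.*-identityʳ 𝟏)) (XR.*-cong (XR.sym 𝟏′≋𝟏) (XR.refl {𝟏})))
                                       (XR.refl {D f}) ⟩
    𝟏′ ⊛ 𝟏 ⊛ D f          ∎
  D-powX-suc f (suc k) = begin
    D (f ⊛ P₁)                              ≈⟨ XD.D-⊛ f P₁ ⟩
    D f ⊛ P₁ ⊕ f ⊛ D P₁                     ≈⟨ XR.+-cong (XR.refl {D f ⊛ P₁}) (XR.*-cong (XR.refl {f}) (D-powX-suc f k)) ⟩
    D f ⊛ (f ⊛ P₀) ⊕ f ⊛ (n ⊛ P₀ ⊛ D f)    ≈⟨ collect f P₀ (D f) n ⟩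
    (𝟏′ ⊕ n) ⊛ (f ⊛ P₀) ⊛ D f               ≈⟨ XR.*-cong (XR.*-cong (numeralX-suc (suc k)) (XR.refl {f ⊛ P₀})) (XR.refl {D f}) ⟨
    numeralX (suc (suc k)) ⊛ P₁ ⊛ D f       ∎
    where
    P₀ = powX f k
    P₁ = powX f (suc k)
    n = numeralX (suc k)
    open SolverX
    collect : ∀ f P Df n → Df ⊛ (f ⊛ P) ⊕ f ⊛ (n ⊛ P ⊛ Df) ≋ (𝟏′ ⊕ n) ⊛ (f ⊛ P) ⊛ Df
    collect = solve 4 (λ f P Df n → Df :* (f :* P) :+ f :* (n :* P :* Df) := (con 1ℚ :+ n) :* (f :* P) :* Df) XR.refl

  D-powX : ∀ f k → D (powX f k) ≋ numeralX k ⊛ powX f (k ∸ 1) ⊛ D f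
  D-powX f zero = begin
    D 𝟏                             ≈⟨ D-constX 1S ⟩
    𝟎                               ≈⟨ XR.zeroˡ (D f) ⟨
    𝟎 ⊛ D f                         ≈⟨ XR.*-cong (XR.trans (XR.*-cong numeralX-zero (XR.refl {𝟏})) (XR.zeroˡ 𝟏)) (XR.refl {D f}) ⟨
    numeralX 0 ⊛ 𝟏 ⊛ D f            ∎
  D-powX f (suc k) = D-powX-suc f k

  -- For k = 0 both sides vanish, because of the factor numeralX 0.
  numeralX-⊛-powX-pred : ∀ f k → numeralX k ⊛ powX f (k ∸ 1) ⊛ f ≋ numeralX k ⊛ powX f k
  numeralX-⊛-powX-pred f zero =
    XR.trans (XR.*-assoc (numeralX 0) 𝟏 f)
      (XR.trans (XR.*-cong numeralX-zero (XR.refl {𝟏 ⊛ f}))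
        (XR.trans (XR.zeroˡ (𝟏 ⊛ f)) (XR.sym (XR.trans (XR.*-cong numeralX-zero (XR.refl {𝟏})) (XR.zeroˡ 𝟏)))))
  numeralX-⊛-powX-pred f (suc k) =
    XR.trans (XR.*-assoc (numeralX (suc k)) (powX f k) f)
      (XR.*-cong (XR.refl {numeralX (suc k)}) (XR.*-comm (powX f k) f))

  column : ℕ → X
  column k = Ggf ⊛ powX Fgf k

  -- This three-term recurrence is what makes the production matrix tridiagonal.
  D-column : ∀ k → D (column k) ≋ numeralX k ⊛ column (k ∸ 1)
                                 ⊕ numeralX (suc k) ⊛ (𝟏′ ⊕ yX) ⊛ column k
                                 ⊕ numeralX (suc k) ⊛ yX ⊛ column (suc k)
  D-column k = begin
    D (G ⊛ Fᵏ)                                                  ≈⟨ XD.D-⊛ G Fᵏ ⟩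
    D G ⊛ Fᵏ ⊕ G ⊛ D Fᵏ                                          ≈⟨ XR.+-cong (XR.*-cong D-Ggf (XR.refl {Fᵏ}))
                                                                            (XR.*-cong (XR.refl {G}) (D-powX F k)) ⟩
    G ⊛ (𝟏′ ⊕ Y ⊕ Y ⊛ F) ⊛ Fᵏ ⊕ G ⊛ (n ⊛ Fᵏ⁻¹ ⊛ D F)              ≈⟨ XR.+-cong (XR.refl {G ⊛ (𝟏′ ⊕ Y ⊕ Y ⊛ F) ⊛ Fᵏ})
                                                                            (XR.*-cong (XR.refl {G}) (XR.*-cong (XR.refl {n ⊛ Fᵏ⁻¹}) D-Fgf)) ⟩
    G ⊛ (𝟏′ ⊕ Y ⊕ Y ⊛ F) ⊛ Fᵏ ⊕ G ⊛ (n ⊛ Fᵏ⁻¹ ⊛ ((𝟏′ ⊕ F) ⊛ (𝟏′ ⊕ Y ⊛ F)))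
                                                               ≈⟨ expand G Y F Fᵏ Fᵏ⁻¹ n ⟩
    n ⊛ (G ⊛ Fᵏ⁻¹) ⊕ (𝟏′ ⊕ Y) ⊛ G ⊛ (n ⊛ Fᵏ⁻¹ ⊛ F) ⊕ Y ⊛ G ⊛ F ⊛ (n ⊛ Fᵏ⁻¹ ⊛ F) ⊕ G ⊛ (𝟏′ ⊕ Y ⊕ Y ⊛ F) ⊛ Fᵏ
      ≈⟨ XR.+-cong (XR.+-cong (XR.+-cong (XR.refl {n ⊛ (G ⊛ Fᵏ⁻¹)})
                                         (XR.*-cong (XR.refl {(𝟏′ ⊕ Y) ⊛ G}) (numeralX-⊛-powX-pred F k)))
                              (XR.*-cong (XR.refl {Y ⊛ G ⊛ F}) (numeralX-⊛-powX-pred F k)))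
                   (XR.refl {G ⊛ (𝟏′ ⊕ Y ⊕ Y ⊛ F) ⊛ Fᵏ}) ⟩
    n ⊛ (G ⊛ Fᵏ⁻¹) ⊕ (𝟏′ ⊕ Y) ⊛ G ⊛ (n ⊛ Fᵏ) ⊕ Y ⊛ G ⊛ F ⊛ (n ⊛ Fᵏ) ⊕ G ⊛ (𝟏′ ⊕ Y ⊕ Y ⊛ F) ⊛ Fᵏ
                                                               ≈⟨ collect G Y F Fᵏ Fᵏ⁻¹ n ⟩
    n ⊛ (G ⊛ Fᵏ⁻¹) ⊕ (𝟏′ ⊕ n) ⊛ (𝟏′ ⊕ Y) ⊛ (G ⊛ Fᵏ) ⊕ (𝟏′ ⊕ n) ⊛ Y ⊛ (G ⊛ (F ⊛ Fᵏ))
      ≈⟨ XR.+-cong (XR.+-cong (XR.refl {n ⊛ (G ⊛ Fᵏ⁻¹)})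
                              (XR.*-cong (XR.*-cong (numeralX-suc k) (XR.refl {𝟏′ ⊕ Y})) (XR.refl {G ⊛ Fᵏ})))
                   (XR.*-cong (XR.*-cong (numeralX-suc k) (XR.refl {Y})) (XR.refl {G ⊛ (F ⊛ Fᵏ)})) ⟨
    n ⊛ column (k ∸ 1) ⊕ numeralX (suc k) ⊛ (𝟏′ ⊕ Y) ⊛ column k ⊕ numeralX (suc k) ⊛ Y ⊛ column (suc k)
                                                               ∎
    where
    G = Ggf
    F = Fgf
    Y = yX
    Fᵏ = powX F k
    Fᵏ⁻¹ = powX F (k ∸ 1)
    n = numeralX k
    open SolverX
    expand : ∀ G Y F P P₋ n →
      G ⊛ (𝟏′ ⊕ Y ⊕ Y ⊛ F) ⊛ P ⊕ G ⊛ (n ⊛ P₋ ⊛ ((𝟏′ ⊕ F) ⊛ (𝟏′ ⊕ Y ⊛ F)))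
        ≋ n ⊛ (G ⊛ P₋) ⊕ (𝟏′ ⊕ Y) ⊛ G ⊛ (n ⊛ P₋ ⊛ F) ⊕ Y ⊛ G ⊛ F ⊛ (n ⊛ P₋ ⊛ F) ⊕ G ⊛ (𝟏′ ⊕ Y ⊕ Y ⊛ F) ⊛ P
    expand = solve 6 (λ G Y F P P₋ n →
      G :* (con 1ℚ :+ Y :+ Y :* F) :* P :+ G :* (n :* P₋ :* ((con 1ℚ :+ F) :* (con 1ℚ :+ Y :* F)))
        := n :* (G :* P₋) :+ (con 1ℚ :+ Y) :* G :* (n :* P₋ :* F) :+ Y :* G :* F :* (n :* P₋ :* F)
           :+ G :* (con 1ℚ :+ Y :+ Y :* F) :* P) XR.refl
    collect : ∀ G Y F P P₋ n →
      n ⊛ (G ⊛ P₋) ⊕ (𝟏′ ⊕ Y) ⊛ G ⊛ (n ⊛ P) ⊕ Y ⊛ G ⊛ F ⊛ (n ⊛ P) ⊕ G ⊛ (𝟏′ ⊕ Y ⊕ Y ⊛ F) ⊛ P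
        ≋ n ⊛ (G ⊛ P₋) ⊕ (𝟏′ ⊕ n) ⊛ (𝟏′ ⊕ Y) ⊛ (G ⊛ P) ⊕ (𝟏′ ⊕ n) ⊛ Y ⊛ (G ⊛ (F ⊛ P))
    collect = solve 6 (λ G Y F P P₋ n →
      n :* (G :* P₋) :+ (con 1ℚ :+ Y) :* G :* (n :* P) :+ Y :* G :* F :* (n :* P) :+ G :* (con 1ℚ :+ Y :+ Y :* F) :* P
        := n :* (G :* P₋) :+ (con 1ℚ :+ n) :* (con 1ℚ :+ Y) :* (G :* P) :+ (con 1ℚ :+ n) :* Y :* (G :* (F :* P))) XR.refl

weight : ℕ → ℕ → ℚ
weight n k = ℕtoℚ (n !) ℚ.* invℚ (ℕtoℚ (k !))

weight-suc : ∀ n k → weight (suc n) k ≡ weight n k ℚ.* ℕtoℚ (suc n)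
weight-suc n k = ≡.trans (≡.cong (ℚ._* invℚ (ℕtoℚ (k !))) (ℕtoℚ-* (suc n) (n !)))
  (regroup (ℕtoℚ (suc n)) (ℕtoℚ (n !)) (invℚ (ℕtoℚ (k !))))
  where
  open import Data.Rational.Solver using (module +-*-Solver)
  open +-*-Solver
  regroup : ∀ a b c → (a ℚ.* b) ℚ.* c ≡ (b ℚ.* c) ℚ.* a
  regroup = solve 3 (λ a b c → (a :* b) :* c := (b :* c) :* a) ≡.refl

weight-≡-weight-suc : ∀ n k → weight n k ≡ weight n (suc k) ℚ.* ℕtoℚ (suc k)
weight-≡-weight-suc n k = ≡.sym (≡.trans (ℚP.*-assoc (ℕtoℚ (n !)) _ _)
  (≡.cong (ℕtoℚ (n !) ℚ.*_) (≡.trans (ℚP.*-comm _ (ℕtoℚ (suc k))) (suc*invℚ[suc!]≡invℚ[!] k))))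

Mom-suc : ∀ n k → Mom (suc n) k ≐ scaleS (weight n k) (D (column k) n)
Mom-suc n k m = ≡.trans (≡.cong (ℚ._* column k (suc n) m) (weight-suc n k))
  (≡.trans (ℚP.*-assoc (weight n k) (ℕtoℚ (suc n)) (column k (suc n) m))
  (≡.cong (weight n k ℚ.*_) (≡.sym (SPS.κ-⊛ (ℕtoℚ (suc n)) (column k (suc n)) m))))

diagonalEntry subdiagonalEntry : ℕ → S
diagonalEntry k = numeral (suc k) *ₛ (SPS.κ 1ℚ +ₛ yS)
subdiagonalEntry k = SPS.κ (ℕtoℚ (suc k) ℚ.* ℕtoℚ (suc k)) *ₛ yS

κX-⊛ : ∀ s t → XPS.κ s ⊛ XPS.κ t ≋ XPS.κ (s SPS.⊛ t)
κX-⊛ s t zero = XPS.κ-⊛ s (XPS.κ t) zero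
κX-⊛ s t (suc n) = SR.trans (XPS.κ-⊛ s (XPS.κ t) (suc n)) (SR.zeroʳ s)

κX-⊕ : ∀ s t → XPS.κ s ⊕ XPS.κ t ≋ XPS.κ (s SPS.⊕ t)
κX-⊕ s t zero m = ≡.refl
κX-⊕ s t (suc n) m = ≡.refl

D-column-coefficient : ∀ k n →
  D (column k) n ≈ₛ numeral k *ₛ column (k ∸ 1) n
                    +ₛ diagonalEntry k *ₛ column k n
                    +ₛ (numeral (suc k) *ₛ yS) *ₛ column (suc k) n
D-column-coefficient k n = SR.trans (D-column k n)
  (SR.+-cong (SR.+-cong (XPS.κ-⊛ (numeral k) (column (k ∸ 1)) n)
                        (SR.trans (XR.*-cong diagonal (XR.refl {column k}) n) (XPS.κ-⊛ (diagonalEntry k) (column k) n)))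
             (SR.trans (XR.*-cong sub (XR.refl {column (suc k)}) n) (XPS.κ-⊛ (numeral (suc k) *ₛ yS) (column (suc k)) n)))
  where
  diagonal : numeralX (suc k) ⊛ (𝟏′ ⊕ yX) ≋ XPS.κ (diagonalEntry k)
  diagonal = XR.trans (XR.*-cong (XR.refl {numeralX (suc k)})
                                 (XR.trans (XR.+-cong (XR.refl {𝟏′}) (constX≋κ yS)) (κX-⊕ (SPS.κ 1ℚ) yS)))
                      (κX-⊛ (numeral (suc k)) (SPS.κ 1ℚ +ₛ yS))
  sub : numeralX (suc k) ⊛ yX ≋ XPS.κ (numeral (suc k) *ₛ yS)
  sub = XR.trans (XR.*-cong (XR.refl {numeralX (suc k)}) (constX≋κ yS)) (κX-⊛ (numeral (suc k)) yS)

-- Mom n (k - 1), with the junk value 0 at k = 0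
leftEntry : ℕ → ℕ → S
leftEntry n zero = SPS.𝟘
leftEntry n (suc k) = Mom n k

Mom-recurrence : ∀ n k →
  Mom (suc n) k ≈ₛ leftEntry n k +ₛ Mom n k *ₛ diagonalEntry k +ₛ Mom n (suc k) *ₛ subdiagonalEntry k
Mom-recurrence n k = begin
  Mom (suc n) k                            ≈⟨ Mom-suc n k ⟩
  scaleS w (D (column k) n)                ≈⟨ scaleS≐κ-⊛ w (D (column k) n) ⟩
  K w *ₛ D (column k) n                    ≈⟨ SR.*-cong (SR.refl {K w}) (D-column-coefficient k n) ⟩
  K w *ₛ (A₁ +ₛ A₂ +ₛ A₃)                  ≈⟨ distribute (K w) A₁ A₂ A₃ ⟩
  K w *ₛ A₁ +ₛ K w *ₛ A₂ +ₛ K w *ₛ A₃      ≈⟨ SR.+-cong (SR.+-cong (left k) diagonal) sub ⟩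
  leftEntry n k +ₛ Mom n k *ₛ diagonalEntry k +ₛ Mom n (suc k) *ₛ subdiagonalEntry k ∎
  where
  open import Relation.Binary.Reasoning.Setoid SR.setoid
  open SolverS
  K = SPS.κ
  w = weight n k
  w′ = weight n (suc k)
  sk = ℕtoℚ (suc k)
  A₁ = numeral k *ₛ column (k ∸ 1) n
  A₂ = diagonalEntry k *ₛ column k n
  A₃ = (numeral (suc k) *ₛ yS) *ₛ column (suc k) n
  distribute : ∀ w a₁ a₂ a₃ → w *ₛ (a₁ +ₛ a₂ +ₛ a₃) ≈ₛ w *ₛ a₁ +ₛ w *ₛ a₂ +ₛ w *ₛ a₃
  distribute = solve 4 (λ w a₁ a₂ a₃ → w :* (a₁ :+ a₂ :+ a₃) := w :* a₁ :+ w :* a₂ :+ w :* a₃) SR.refl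
  left : ∀ k → K (weight n k) *ₛ (numeral k *ₛ column (k ∸ 1) n) ≈ₛ leftEntry n k
  left zero = SR.trans (SR.*-cong (SR.refl {K (weight n zero)})
                                  (SR.trans (SR.*-cong numeral-zero (SR.refl {column 0 n})) (SR.zeroˡ (column 0 n))))
                       (SR.zeroʳ (K (weight n zero)))
  left (suc j) = begin
    K (weight n (suc j)) *ₛ (numeral (suc j) *ₛ column j n)
      ≈⟨ SR.*-assoc (K (weight n (suc j))) (numeral (suc j)) (column j n) ⟨
    (K (weight n (suc j)) *ₛ numeral (suc j)) *ₛ column j n
      ≈⟨ SR.*-cong {K (weight n (suc j)) *ₛ numeral (suc j)} {K (weight n j)} {column j n} {column j n}
           (λ m → ≡.trans (κ-*-homo _ _ m) (≡.cong (λ z → K z m) (≡.sym (weight-≡-weight-suc n j))))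
           (SR.refl {column j n}) ⟩
    K (weight n j) *ₛ column j n
      ≈⟨ scaleS≐κ-⊛ (weight n j) (column j n) ⟨
    Mom n j ∎
  diagonal : K w *ₛ A₂ ≈ₛ Mom n k *ₛ diagonalEntry k
  diagonal = begin
    K w *ₛ (diagonalEntry k *ₛ column k n)
      ≈⟨ solve 3 (λ w d c → w :* (d :* c) := (w :* c) :* d) SR.refl (K w) (diagonalEntry k) (column k n) ⟩
    (K w *ₛ column k n) *ₛ diagonalEntry k
      ≈⟨ SR.*-cong (SR.sym (scaleS≐κ-⊛ w (column k n))) (SR.refl {diagonalEntry k}) ⟩
    Mom n k *ₛ diagonalEntry k ∎
  sub : K w *ₛ A₃ ≈ₛ Mom n (suc k) *ₛ subdiagonalEntry k
  sub = begin
    K w *ₛ ((K sk *ₛ yS) *ₛ column (suc k) n)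
      ≈⟨ SR.*-cong {K w} {K w′ *ₛ K sk}
           (λ m → ≡.trans (≡.cong (λ z → K z m) (weight-≡-weight-suc n k)) (≡.sym (κ-*-homo w′ sk m)))
           (SR.refl {(K sk *ₛ yS) *ₛ column (suc k) n}) ⟩
    (K w′ *ₛ K sk) *ₛ ((K sk *ₛ yS) *ₛ column (suc k) n)
      ≈⟨ solve 4 (λ w s y c → (w :* s) :* ((s :* y) :* c) := (w :* c) :* ((s :* s) :* y)) SR.refl
           (K w′) (K sk) yS (column (suc k) n) ⟩
    (K w′ *ₛ column (suc k) n) *ₛ ((K sk *ₛ K sk) *ₛ yS)
      ≈⟨ SR.*-cong (SR.sym (scaleS≐κ-⊛ w′ (column (suc k) n)))
                   (SR.*-cong {K sk *ₛ K sk} {K (sk ℚ.* sk)} (κ-*-homo sk sk) (SR.refl {yS})) ⟩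
    Mom n (suc k) *ₛ subdiagonalEntry k ∎

module SΣ = FiniteSums S-ring

module _ where
  open import Relation.Binary.Reasoning.Setoid SR.setoid

  infix 4 _≐ᴹ_
  _≐ᴹ_ : Mat → Mat → Set
  A ≐ᴹ B = ∀ n k → A n k ≐ B n k

  idMat-diagonal : ∀ n → idMat n n ≡ 1S
  idMat-diagonal n rewrite ≤⇒≤ᵇ≡true (ℕP.≤-refl {n}) = ≡.refl

  idMat-< : ∀ {n k} → n < k → idMat n k ≡ 0S
  idMat-< p rewrite ≤⇒≤ᵇ≡true (ℕP.<⇒≤ p) | >⇒≤ᵇ≡false p = ≡.refl

  idMat-≢ : ∀ {n k} → n ≢ k → idMat n k ≡ 0S
  idMat-≢ {n} {k} n≢k with ℕP.<-cmp n k
  ... | tri< p _ _ = idMat-< p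
  ... | tri≈ _ e _ = ⊥-elim (n≢k e)
  ... | tri> _ _ p rewrite >⇒≤ᵇ≡false p = ≡.refl

  ·LT-congˡ : ∀ {A A′} B → A ≐ᴹ A′ → (A ·LT B) ≐ᴹ (A′ ·LT B)
  ·LT-congˡ B e n k = SΣ.Σ-cong′ (suc n) (λ j → SR.*-cong (e n j) (SR.refl {B j k}))

  ·LT-congʳ : ∀ A {B B′} → B ≐ᴹ B′ → (A ·LT B) ≐ᴹ (A ·LT B′)
  ·LT-congʳ A e n k = SΣ.Σ-cong′ (suc n) (λ j → SR.*-cong (SR.refl {A n j}) (e j k))

  ·LT-assoc : ∀ A B C → LowerTriangular B → (A ·LT (B ·LT C)) ≐ᴹ ((A ·LT B) ·LT C)
  ·LT-assoc A B C B-lower n k = begin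
    SΣ.Σ< (suc n) (λ j → A n j *ₛ SΣ.Σ< (suc j) (λ i → B j i *ₛ C i k))
      ≈⟨ SΣ.Σ-cong (suc n) (λ j p → SR.*-cong (SR.refl {A n j}) (extend j (ℕP.≤-pred p))) ⟩
    SΣ.Σ< (suc n) (λ j → A n j *ₛ SΣ.Σ< (suc n) (λ i → B j i *ₛ C i k))
      ≈⟨ SΣ.Σ-cong′ (suc n) (λ j → SR.trans (SΣ.*-Σ (suc n) (A n j) (λ i → B j i *ₛ C i k))
            (SΣ.Σ-cong′ (suc n) (λ i → SR.sym (SR.*-assoc (A n j) (B j i) (C i k))))) ⟩
    SΣ.Σ< (suc n) (λ j → SΣ.Σ< (suc n) (λ i → (A n j *ₛ B j i) *ₛ C i k))
      ≈⟨ SΣ.Σ-swap (suc n) (suc n) (λ j i → (A n j *ₛ B j i) *ₛ C i k) ⟩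
    SΣ.Σ< (suc n) (λ i → SΣ.Σ< (suc n) (λ j → (A n j *ₛ B j i) *ₛ C i k))
      ≈⟨ SΣ.Σ-cong′ (suc n) (λ i → SR.sym (SΣ.Σ-* (suc n) (C i k) (λ j → A n j *ₛ B j i))) ⟩
    SΣ.Σ< (suc n) (λ i → SΣ.Σ< (suc n) (λ j → A n j *ₛ B j i) *ₛ C i k) ∎
    where
    extend : ∀ j → j ≤ n → (B ·LT C) j k ≈ₛ SΣ.Σ< (suc n) (λ i → B j i *ₛ C i k)
    extend j j≤n = SR.sym (SΣ.Σ-truncate j n (λ i → B j i *ₛ C i k) j≤n
      (λ i j<i _ → SR.trans (SR.*-cong (B-lower j i j<i) (SR.refl {C i k})) (SR.zeroˡ (C i k))))

  idMat-·LT : ∀ C → (idMat ·LT C) ≐ᴹ C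
  idMat-·LT C n k = SR.trans
    (SΣ.Σ-single (suc n) n (ℕP.n<1+n n)
      (λ i _ i≢n → SR.trans (SR.*-cong (SR.reflexive (idMat-≢ (λ e → i≢n (≡.sym e)))) (SR.refl {C i k}))
                            (SR.zeroˡ (C i k))))
    (SR.trans (SR.*-cong (SR.reflexive (idMat-diagonal n)) (SR.refl {C n k})) (SR.*-identityˡ (C n k)))

  ·LT-idMat : ∀ A → LowerTriangular A → (A ·LT idMat) ≐ᴹ A
  ·LT-idMat A A-lower n k with ℕP.<-cmp k (suc n)
  ... | tri< k≤n _ _ = SR.trans
    (SΣ.Σ-single (suc n) k k≤n
      (λ i _ i≢k → SR.trans (SR.*-cong (SR.refl {A n i}) (SR.reflexive (idMat-≢ i≢k))) (SR.zeroʳ (A n i))))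
    (SR.trans (SR.*-cong (SR.refl {A n k}) (SR.reflexive (idMat-diagonal k))) (SR.*-identityʳ (A n k)))
  ... | tri≈ _ k≡1+n _ = SR.trans
    (SΣ.Σ-zero (suc n) (λ i i≤n → SR.trans
      (SR.*-cong (SR.refl {A n i}) (SR.reflexive (idMat-< (ℕP.<-≤-trans i≤n (ℕP.≤-reflexive (≡.sym k≡1+n))))))
      (SR.zeroʳ (A n i))))
    (SR.sym (A-lower n k (ℕP.≤-reflexive (≡.sym k≡1+n))))
  ... | tri> _ _ 1+n<k = SR.trans
    (SΣ.Σ-zero (suc n) (λ i i≤n → SR.trans
      (SR.*-cong (SR.refl {A n i}) (SR.reflexive (idMat-< (ℕP.<-trans i≤n 1+n<k))))
      (SR.zeroʳ (A n i))))
    (SR.sym (A-lower n k (ℕP.<-trans (ℕP.n<1+n n) 1+n<k)))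

  module ForwardSubstitution (M : Mat) where

    initial : ℕ → S
    initial k = invS (M k k)

    step : ℕ → ℕ → (ℕ → S) → S
    step k d h = -S (invS (M (k ℕ.+ suc d) (k ℕ.+ suc d))
                     *S ΣS (suc d) (λ j → M (k ℕ.+ suc d) (k ℕ.+ j) *S h j))

    -- column k of invLT M, indexed by the distance d = n ∸ k below the diagonal
    inverseColumn : ℕ → ℕ → S
    inverseColumn k = cov (initial k) (step k)

    invLT-< : ∀ {n k} → n < k → invLT M n k ≡ 0S
    invLT-< p = if-false (>⇒≤ᵇ≡false p)

    invLT-inverseColumn : ∀ k d → invLT M (k ℕ.+ d) k ≡ inverseColumn k d
    invLT-inverseColumn k d = ≡.trans (if-true (≤⇒≤ᵇ≡true (ℕP.m≤m+n k d))) (≡.cong (inverseColumn k) (ℕP.m+n∸m≡n k d))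

    invLT-lower : LowerTriangular (invLT M)
    invLT-lower n k p = SR.reflexive (invLT-< p)

    invLT-diagonal : ∀ k → invLT M k k ≡ invS (M k k)
    invLT-diagonal k = ≡.subst (λ n → invLT M n k ≡ inverseColumn k 0) (ℕP.+-identityʳ k) (invLT-inverseColumn k 0)

    module _ (diagonal-invertible : ∀ k → M k k *ₛ invS (M k k) ≈ₛ 1S) where

      inverseColumn-solves : ∀ k d → SΣ.Σ< (suc d) (λ t → M (k ℕ.+ d) (k ℕ.+ t) *ₛ inverseColumn k t) ≈ₛ idMat (k ℕ.+ d) k
      inverseColumn-solves k zero rewrite ℕP.+-identityʳ k =
        SR.trans (SR.+-identityˡ _) (SR.trans (diagonal-invertible k) (SR.reflexive (≡.sym (idMat-diagonal k))))
      inverseColumn-solves k (suc d) = begin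
        T +ₛ Mₙₙ *ₛ inverseColumn k (suc d)      ≈⟨ SR.+-cong (SR.refl {T}) (SR.*-cong (SR.refl {Mₙₙ}) (SR.reflexive (cov-suc d))) ⟩
        T +ₛ Mₙₙ *ₛ (-ₛ (Mₙₙ⁻¹ *ₛ T′))    ≈⟨ SR.+-cong (SR.refl {T}) (SR.*-cong (SR.refl {Mₙₙ}) (SR.-‿cong (SR.*-cong (SR.refl {Mₙₙ⁻¹}) T≈T′))) ⟨
        T +ₛ Mₙₙ *ₛ (-ₛ (Mₙₙ⁻¹ *ₛ T))     ≈⟨ SR.+-cong (SR.refl {T}) (-‿distribʳ-* Mₙₙ (Mₙₙ⁻¹ *ₛ T)) ⟨
        T +ₛ -ₛ (Mₙₙ *ₛ (Mₙₙ⁻¹ *ₛ T))     ≈⟨ SR.+-cong (SR.refl {T}) (SR.-‿cong cancel) ⟩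
        T +ₛ -ₛ T                         ≈⟨ SR.-‿inverseʳ T ⟩
        SPS.𝟘                             ≈⟨ SR.reflexive (idMat-≢ (ℕP.m+1+n≢m k)) ⟨
        idMat (k ℕ.+ suc d) k             ∎
        where
        open import Algebra.Properties.Ring SR.ring using (-‿distribʳ-*)
        open CourseOfValues (initial k) (step k)
        n = k ℕ.+ suc d
        Mₙₙ = M n n
        Mₙₙ⁻¹ = invS Mₙₙ
        T = SΣ.Σ< (suc d) (λ t → M n (k ℕ.+ t) *ₛ inverseColumn k t)
        T′ = SΣ.Σ< (suc d) (λ t → M n (k ℕ.+ t) *ₛ table d t)
        T≈T′ : T ≈ₛ T′
        T≈T′ = SΣ.Σ-cong (suc d) (λ t p → SR.*-cong (SR.refl {M n (k ℕ.+ t)})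
                                                    (SR.reflexive (≡.sym (table-cov d t (ℕP.≤-pred p)))))
        cancel : Mₙₙ *ₛ (Mₙₙ⁻¹ *ₛ T) ≈ₛ T
        cancel = SR.trans (SR.sym (SR.*-assoc Mₙₙ Mₙₙ⁻¹ T))
                          (SR.trans (SR.*-cong (diagonal-invertible n) (SR.refl {T})) (SR.*-identityˡ T))

      ·LT-invLT-below : ∀ k d → (M ·LT invLT M) (k ℕ.+ d) k ≈ₛ idMat (k ℕ.+ d) k
      ·LT-invLT-below k d = begin
        SΣ.Σ< (suc (k ℕ.+ d)) g                                            ≈⟨ SΣ.Σ-length g (≡.sym (ℕP.+-suc k d)) ⟩
        SΣ.Σ< (k ℕ.+ suc d) g                                              ≈⟨ SΣ.Σ-split k (suc d) g ⟩
        SΣ.Σ< k g +ₛ SΣ.Σ< (suc d) (λ t → g (k ℕ.+ t))                     ≈⟨ SR.+-cong above on-and-below ⟩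
        SPS.𝟘 +ₛ SΣ.Σ< (suc d) (λ t → M (k ℕ.+ d) (k ℕ.+ t) *ₛ inverseColumn k t) ≈⟨ SR.+-identityˡ _ ⟩
        SΣ.Σ< (suc d) (λ t → M (k ℕ.+ d) (k ℕ.+ t) *ₛ inverseColumn k t)          ≈⟨ inverseColumn-solves k d ⟩
        idMat (k ℕ.+ d) k                                                  ∎
        where
        g : ℕ → S
        g j = M (k ℕ.+ d) j *ₛ invLT M j k
        above : SΣ.Σ< k g ≈ₛ SPS.𝟘
        above = SΣ.Σ-zero k (λ j p → SR.trans (SR.*-cong (SR.refl {M (k ℕ.+ d) j}) (SR.reflexive (invLT-< p)))
                                              (SR.zeroʳ (M (k ℕ.+ d) j)))
        on-and-below : SΣ.Σ< (suc d) (λ t → g (k ℕ.+ t)) ≈ₛ SΣ.Σ< (suc d) (λ t → M (k ℕ.+ d) (k ℕ.+ t) *ₛ inverseColumn k t)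
        on-and-below = SΣ.Σ-cong′ (suc d) (λ t → SR.*-cong (SR.refl {M (k ℕ.+ d) (k ℕ.+ t)})
                                                           (SR.reflexive (invLT-inverseColumn k t)))

      ·LT-invLT : (M ·LT invLT M) ≐ᴹ idMat
      ·LT-invLT n k with ℕP.<-cmp n k
      ... | tri< n<k _ _ = SR.trans
        (SΣ.Σ-zero (suc n) (λ j j≤n → SR.trans
          (SR.*-cong (SR.refl {M n j}) (SR.reflexive (invLT-< (ℕP.≤-<-trans (ℕP.≤-pred j≤n) n<k))))
          (SR.zeroʳ (M n j))))
        (SR.reflexive (≡.sym (idMat-< n<k)))
      ... | tri≈ _ n≡k _ = ≡.subst (λ n → (M ·LT invLT M) n k ≈ₛ idMat n k)
                                   (≡.trans (ℕP.+-identityʳ k) (≡.sym n≡k)) (·LT-invLT-below k 0)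
      ... | tri> _ _ k<n = ≡.subst (λ n → (M ·LT invLT M) n k ≈ₛ idMat n k)
                                   (ℕP.m+[n∸m]≡n (ℕP.<⇒≤ k<n)) (·LT-invLT-below k (n ∸ k))

  open ForwardSubstitution using (invLT-lower; invLT-diagonal; ·LT-invLT)

  *-invS-one : ∀ s → s ≐ 1S → s *ₛ invS s ≈ₛ 1S
  *-invS-one s s≐1 = ⊛-invS s (≡.subst (λ z → invℚ z ℚ.* z ≡ 1ℚ) (≡.sym (s≐1 0)) ≡.refl)

  -- A right inverse of a lower unitriangular matrix is also a left inverse, because
  -- invLT M has a right inverse of its own.
  invLT-inverse : ∀ M → LowerTriangular M → (∀ k → M k k ≐ 1S) →
                  (invLT M ·LT M) ≐ᴹ idMat × (M ·LT invLT M) ≐ᴹ idMat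
  invLT-inverse M M-lower M-unit = left , right
    where
    B = invLT M
    C = invLT B
    B-unit : ∀ k → B k k ≐ 1S
    B-unit k = begin
      B k k                ≈⟨ SR.reflexive (invLT-diagonal M k) ⟩
      invS (M k k)         ≈⟨ SR.*-identityˡ (invS (M k k)) ⟨
      1S *ₛ invS (M k k)   ≈⟨ SR.*-cong (M-unit k) (SR.refl {invS (M k k)}) ⟨
      M k k *ₛ invS (M k k) ≈⟨ *-invS-one (M k k) (M-unit k) ⟩
      1S                   ∎
    right : (M ·LT B) ≐ᴹ idMat
    right = ·LT-invLT M (λ k → *-invS-one (M k k) (M-unit k))
    B·C≐I : (B ·LT C) ≐ᴹ idMat
    B·C≐I = ·LT-invLT B (λ k → *-invS-one (B k k) (B-unit k))
    M≐C : M ≐ᴹ C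
    M≐C n k = begin
      M n k                  ≈⟨ ·LT-idMat M M-lower n k ⟨
      (M ·LT idMat) n k      ≈⟨ ·LT-congʳ M B·C≐I n k ⟨
      (M ·LT (B ·LT C)) n k  ≈⟨ ·LT-assoc M B C (invLT-lower M) n k ⟩
      ((M ·LT B) ·LT C) n k  ≈⟨ ·LT-congˡ C right n k ⟩
      (idMat ·LT C) n k      ≈⟨ idMat-·LT C n k ⟩
      C n k                  ∎
    left : (B ·LT M) ≐ᴹ idMat
    left n k = SR.trans (·LT-congʳ B M≐C n k) (B·C≐I n k)

  ⊛-constant : ∀ f g → (f ⊛ g) 0 ≈ₛ f 0 *ₛ g 0
  ⊛-constant f g = SR.+-identityˡ (f 0 *ₛ g 0)

  module PowersOfOrderOne (f : X) (f₀≈0 : f 0 ≈ₛ SPS.𝟘) where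

    powX-< : ∀ k n → n < k → powX f k n ≈ₛ SPS.𝟘
    powX-< (suc k) n n≤k = SΣ.Σ-zero (suc n) term
      where
      term : ∀ i → i < suc n → f i *ₛ powX f k (n ∸ i) ≈ₛ SPS.𝟘
      term zero _ = SR.trans (SR.*-cong f₀≈0 (SR.refl {powX f k n})) (SR.zeroˡ (powX f k n))
      term (suc i) (s≤s i<n) = SR.trans
        (SR.*-cong (SR.refl {f (suc i)})
                   (powX-< k (n ∸ suc i) (ℕP.<-≤-trans (ℕP.∸-monoʳ-< (s≤s z≤n) i<n) (ℕP.≤-pred n≤k))))
        (SR.zeroʳ (f (suc i)))

    powX-diagonal : f 1 ≈ₛ 1S → ∀ k → powX f k k ≈ₛ 1S
    powX-diagonal f₁≈1 zero = SR.refl {1S}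
    powX-diagonal f₁≈1 (suc k) = SR.trans (SΣ.Σ-single (suc (suc k)) 1 (s≤s (s≤s z≤n)) term)
      (SR.trans (SR.*-cong f₁≈1 (powX-diagonal f₁≈1 k)) (SR.*-identityˡ 1S))
      where
      term : ∀ i → i < suc (suc k) → i ≢ 1 → f i *ₛ powX f k (suc k ∸ i) ≈ₛ SPS.𝟘
      term zero _ _ = SR.trans (SR.*-cong f₀≈0 (SR.refl {powX f k (suc k)})) (SR.zeroˡ (powX f k (suc k)))
      term (suc zero) _ i≢1 = ⊥-elim (i≢1 ≡.refl)
      term (suc (suc i)) (s≤s (s≤s i≤k)) _ = SR.trans
        (SR.*-cong (SR.refl {f (suc (suc i))})
                   (powX-< k (k ∸ suc i) (ℕP.<-≤-trans (ℕP.∸-monoʳ-< (s≤s z≤n) i≤k) ℕP.≤-refl)))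
        (SR.zeroʳ (f (suc (suc i))))

  numF-zero : numF 0 ≈ₛ SPS.𝟘
  numF-zero = SR.trans (SR.+-cong (expX-zero 1S) (SR.-‿cong (expX-zero yS))) (SR.-‿inverseʳ 1S)

  Fgf-zero : Fgf 0 ≈ₛ SPS.𝟘
  Fgf-zero = begin
    (numF ⊛ denF⁻¹) 0      ≈⟨ ⊛-constant numF denF⁻¹ ⟩
    numF 0 *ₛ denF⁻¹ 0     ≈⟨ SR.*-cong numF-zero (SR.refl {denF⁻¹ 0}) ⟩
    SPS.𝟘 *ₛ denF⁻¹ 0      ≈⟨ SR.zeroˡ (denF⁻¹ 0) ⟩
    SPS.𝟘                  ∎

  Fgf-one : Fgf 1 ≈ₛ 1S
  Fgf-one = begin
    (SPS.𝟘 +ₛ numF 0 *ₛ denF⁻¹ 1) +ₛ numF 1 *ₛ denF⁻¹ 0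
      ≈⟨ SR.+-cong (SR.trans (SR.+-identityˡ (numF 0 *ₛ denF⁻¹ 1))
                             (SR.trans (SR.*-cong numF-zero (SR.refl {denF⁻¹ 1})) (SR.zeroˡ (denF⁻¹ 1))))
                   (SR.*-cong numF₁≈denF₀ (SR.refl {denF⁻¹ 0})) ⟩
    SPS.𝟘 +ₛ denF 0 *ₛ denF⁻¹ 0   ≈⟨ denF⊛denF⁻¹ 0 ⟩
    1S                            ∎
    where
    denF₀≈1-y : denF 0 ≈ₛ SR._-_ 1S yS
    denF₀≈1-y = SR.+-cong (expX-zero yS)
      (SR.-‿cong (SR.trans (⊛-constant yX eˣ) (SR.trans (SR.*-cong (SR.refl {yS}) (expX-zero 1S)) (SR.*-identityʳ yS))))
    numF₁≈denF₀ : numF 1 ≈ₛ denF 0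
    numF₁≈denF₀ = SR.trans (SR.+-cong (expX-one 1S) (SR.-‿cong (expX-one yS))) (SR.sym denF₀≈1-y)

  Ggf-zero : Ggf 0 ≈ₛ 1S
  Ggf-zero = begin
    (y-1X ⊛ eʸˣ ⊛ denG⁻¹) 0       ≈⟨ ⊛-constant (y-1X ⊛ eʸˣ) denG⁻¹ ⟩
    (y-1X ⊛ eʸˣ) 0 *ₛ denG⁻¹ 0     ≈⟨ SR.*-cong (SR.trans (⊛-constant y-1X eʸˣ)
                                                  (SR.trans (SR.*-cong (SR.refl {y-1X 0}) (expX-zero yS)) (SR.*-identityʳ (y-1X 0))))
                                               (SR.refl {denG⁻¹ 0}) ⟩
    y-1X 0 *ₛ denG⁻¹ 0             ≈⟨ SR.*-cong (SR.+-cong (SR.refl {yS}) (SR.-‿cong (SR.sym (expX-zero (yS -S 1S)))))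
                                               (SR.refl {denG⁻¹ 0}) ⟩
    denG 0 *ₛ denG⁻¹ 0             ≈⟨ ⊛-constant denG denG⁻¹ ⟨
    (denG ⊛ denG⁻¹) 0              ≈⟨ denG⊛denG⁻¹ 0 ⟩
    1S                             ∎

  open PowersOfOrderOne Fgf Fgf-zero

  column-< : ∀ k n → n < k → column k n ≈ₛ SPS.𝟘
  column-< k n n<k = SΣ.Σ-zero (suc n) (λ i _ → SR.trans
    (SR.*-cong (SR.refl {Ggf i}) (powX-< k (n ∸ i) (ℕP.≤-<-trans (ℕP.m∸n≤m n i) n<k)))
    (SR.zeroʳ (Ggf i)))

  column-diagonal : ∀ k → column k k ≈ₛ 1S
  column-diagonal k = SR.trans (SΣ.Σ-single (suc k) 0 (s≤s z≤n) term)
    (SR.trans (SR.*-cong Ggf-zero (powX-diagonal Fgf-one k)) (SR.*-identityˡ 1S))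
    where
    term : ∀ i → i < suc k → i ≢ 0 → Ggf i *ₛ powX Fgf k (k ∸ i) ≈ₛ SPS.𝟘
    term zero _ i≢0 = ⊥-elim (i≢0 ≡.refl)
    term (suc i) (s≤s i<k) _ = SR.trans
      (SR.*-cong (SR.refl {Ggf (suc i)}) (powX-< k (k ∸ suc i) (ℕP.∸-monoʳ-< (s≤s z≤n) i<k)))
      (SR.zeroʳ (Ggf (suc i)))

  Mom-lower : LowerTriangular Mom
  Mom-lower n k n<k m = ≡.trans (≡.cong (weight n k ℚ.*_) (column-< k n n<k m)) (ℚP.*-zeroʳ (weight n k))

  Mom-diagonal : ∀ k → Mom k k ≐ 1S
  Mom-diagonal k m = ≡.trans (≡.cong₂ ℚ._*_ (invℚ-inverseʳ _ (ℕtoℚ-!≢0 k)) (column-diagonal k m)) (ℚP.*-identityˡ (1S m))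

  Mom-first-column : ∀ n → Mom n 0 ≐ P n
  Mom-first-column n m = ≡.cong₂ ℚ._*_ (ℚP.*-identityʳ (ℕtoℚ (n !))) (XR.*-identityʳ Ggf n m)

  onlyAt : ℕ → ℕ → S → S
  onlyAt j m c = if does (j ℕ.≟ m) then c else 0S

  onlyAt-≡ : ∀ m c → onlyAt m m c ≡ c
  onlyAt-≡ m c = ≡.cong (if_then c else 0S) (dec-true (m ℕ.≟ m) ≡.refl)

  onlyAt-≢ : ∀ {j m} c → j ≢ m → onlyAt j m c ≡ 0S
  onlyAt-≢ {j} {m} c j≢m = ≡.cong (if_then c else 0S) (dec-false (j ℕ.≟ m) j≢m)

  Σ-onlyAt : ∀ n m c (g : ℕ → S) → (n < m → g m ≈ₛ SPS.𝟘) →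
             SΣ.Σ< (suc n) (λ j → g j *ₛ onlyAt j m c) ≈ₛ g m *ₛ c
  Σ-onlyAt n m c g g-beyond with m ℕP.≤? n
  ... | yes m≤n = SR.trans
    (SΣ.Σ-single (suc n) m (ℕ.s≤s m≤n)
      (λ i _ i≢m → SR.trans (SR.*-cong (SR.refl {g i}) (SR.reflexive (onlyAt-≢ c i≢m))) (SR.zeroʳ (g i))))
    (SR.*-cong (SR.refl {g m}) (SR.reflexive (onlyAt-≡ m c)))
  ... | no m≰n = SR.trans
    (SΣ.Σ-zero (suc n) (λ i i≤n → SR.trans
      (SR.*-cong (SR.refl {g i}) (SR.reflexive (onlyAt-≢ c (λ i≡m → ℕP.<-irrefl i≡m (ℕP.<-≤-trans i≤n n<m)))))
      (SR.zeroʳ (g i))))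
    (SR.sym (SR.trans (SR.*-cong (g-beyond n<m) (SR.refl {c})) (SR.zeroˡ c)))
    where
    n<m = ℕP.≰⇒> m≰n

  tridiagonal : Mat
  tridiagonal j k = onlyAt (suc j) k 1S +S onlyAt j k (diagonalEntry k) +S onlyAt j (suc k) (subdiagonalEntry k)

  Mom-·LT-tridiagonal : ∀ n k →
    (Mom ·LT tridiagonal) n k ≈ₛ leftEntry n k +ₛ Mom n k *ₛ diagonalEntry k +ₛ Mom n (suc k) *ₛ subdiagonalEntry k
  Mom-·LT-tridiagonal n k = begin
    SΣ.Σ< (suc n) (λ j → Mom n j *ₛ tridiagonal j k)
      ≈⟨ SΣ.Σ-cong′ (suc n) (λ j → distribute (Mom n j) (onlyAt (suc j) k 1S) (onlyAt j k (diagonalEntry k)) (onlyAt j (suc k) (subdiagonalEntry k))) ⟩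
    SΣ.Σ< (suc n) (λ j → sup j +ₛ diag j +ₛ sub j)
      ≈⟨ SR.trans (SΣ.Σ-+ (suc n) (λ j → sup j +ₛ diag j) sub) (SR.+-cong (SΣ.Σ-+ (suc n) sup diag) (SR.refl {SΣ.Σ< (suc n) sub})) ⟩
    SΣ.Σ< (suc n) sup +ₛ SΣ.Σ< (suc n) diag +ₛ SΣ.Σ< (suc n) sub
      ≈⟨ SR.+-cong (SR.+-cong (superdiagonal k) (Σ-onlyAt n k (diagonalEntry k) (Mom n) (Mom-lower n k)))
                   (Σ-onlyAt n (suc k) (subdiagonalEntry k) (Mom n) (Mom-lower n (suc k))) ⟩
    leftEntry n k +ₛ Mom n k *ₛ diagonalEntry k +ₛ Mom n (suc k) *ₛ subdiagonalEntry k ∎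
    where
    sup diag sub : ℕ → S
    sup j = Mom n j *ₛ onlyAt (suc j) k 1S
    diag j = Mom n j *ₛ onlyAt j k (diagonalEntry k)
    sub j = Mom n j *ₛ onlyAt j (suc k) (subdiagonalEntry k)
    distribute : ∀ a b c d → a *ₛ (b +ₛ c +ₛ d) ≈ₛ a *ₛ b +ₛ a *ₛ c +ₛ a *ₛ d
    distribute a b c d = SR.trans (SR.distribˡ a (b +ₛ c) d) (SR.+-cong (SR.distribˡ a b c) (SR.refl {a *ₛ d}))
    superdiagonal : ∀ k → SΣ.Σ< (suc n) (λ j → Mom n j *ₛ onlyAt (suc j) k 1S) ≈ₛ leftEntry n k
    superdiagonal zero = SΣ.Σ-zero (suc n) (λ j _ → SR.zeroʳ (Mom n j))
    superdiagonal (suc k) = SR.trans (Σ-onlyAt n k 1S (Mom n) (Mom-lower n k)) (SR.*-identityʳ (Mom n k))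

  production-Mom : production Mom ≐ᴹ tridiagonal
  production-Mom i j = begin
    (invLT Mom ·LT dropRow Mom) i j            ≈⟨ ·LT-congʳ (invLT Mom) dropRow-Mom i j ⟩
    (invLT Mom ·LT (Mom ·LT tridiagonal)) i j  ≈⟨ ·LT-assoc (invLT Mom) Mom tridiagonal Mom-lower i j ⟩
    ((invLT Mom ·LT Mom) ·LT tridiagonal) i j  ≈⟨ ·LT-congˡ tridiagonal (proj₁ (invLT-inverse Mom Mom-lower Mom-diagonal)) i j ⟩
    (idMat ·LT tridiagonal) i j                ≈⟨ idMat-·LT tridiagonal i j ⟩
    tridiagonal i j                            ∎
    where
    dropRow-Mom : dropRow Mom ≐ᴹ (Mom ·LT tridiagonal)
    dropRow-Mom n k = SR.trans (Mom-recurrence n k) (SR.sym (Mom-·LT-tridiagonal n k))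

  tridiagonal-zero : ∀ i j → suc i ≢ j → i ≢ j → i ≢ suc j → tridiagonal i j ≐ 0S
  tridiagonal-zero i j ≢sup ≢diag ≢sub m
    rewrite onlyAt-≢ 1S ≢sup | onlyAt-≢ (diagonalEntry j) ≢diag | onlyAt-≢ (subdiagonalEntry j) ≢sub = ≡.refl

  tridiagonal-above : ∀ i j → suc i < j → tridiagonal i j ≐ 0S
  tridiagonal-above i j i+1<j = tridiagonal-zero i j
    (λ e → ℕP.<-irrefl e i+1<j)
    (λ e → ℕP.<-irrefl e (ℕP.<-trans (ℕP.n<1+n i) i+1<j))
    (λ e → ℕP.<-irrefl e (ℕP.<-trans (ℕP.<-trans (ℕP.n<1+n i) i+1<j) (ℕP.n<1+n j)))

  tridiagonal-below : ∀ i j → suc j < i → tridiagonal i j ≐ 0S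
  tridiagonal-below i j j+1<i = tridiagonal-zero i j
    (λ e → ℕP.<-irrefl (≡.sym e) (ℕP.<-trans (ℕP.<-trans (ℕP.n<1+n j) j+1<i) (ℕP.n<1+n i)))
    (λ e → ℕP.<-irrefl (≡.sym e) (ℕP.<-trans (ℕP.n<1+n j) j+1<i))
    (λ e → ℕP.<-irrefl (≡.sym e) j+1<i)

  tridiagonal-superdiagonal : ∀ i → tridiagonal i (suc i) ≐ 1S
  tridiagonal-superdiagonal i m
    rewrite onlyAt-≡ (suc i) 1S
          | onlyAt-≢ (diagonalEntry (suc i)) (ℕP.<⇒≢ (ℕP.n<1+n i))
          | onlyAt-≢ (subdiagonalEntry (suc i)) (ℕP.<⇒≢ (ℕP.<-trans (ℕP.n<1+n i) (ℕP.n<1+n (suc i)))) = unit m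
    where
    unit : ∀ m → ((1S +S 0S) +S 0S) m ≡ 1S m
    unit zero = ≡.refl
    unit (suc m) = ≡.refl

proposition4 :
    -- [G,F] is lower triangular
    LowerTriangular Mom
    -- it is invertible, with inverse invLT Mom
    × (∀ n k → (invLT Mom ·LT Mom) n k ≐ idMat n k)
    × (∀ n k → (Mom ·LT invLT Mom) n k ≐ idMat n k)
    -- its production matrix is tridiagonal with superdiagonal entries 1
    × (∀ i j → suc i < j → production Mom i j ≐ 0S)
    × (∀ i j → suc j < i → production Mom i j ≐ 0S)
    × (∀ i → production Mom i (suc i) ≐ 1S)
    -- its first column is (P_n(y))_n
    × (∀ n → Mom n 0 ≐ P n)
proposition4 =
    Mom-lower
  , proj₁ Mom-invertible
  , proj₂ Mom-invertible
  , (λ i j i+1<j m → ≡.trans (production-Mom i j m) (tridiagonal-above i j i+1<j m))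
  , (λ i j j+1<i m → ≡.trans (production-Mom i j m) (tridiagonal-below i j j+1<i m))
  , (λ i m → ≡.trans (production-Mom i (suc i) m) (tridiagonal-superdiagonal i m))
  , Mom-first-column
  where
  Mom-invertible : (invLT Mom ·LT Mom) ≐ᴹ idMat × (Mom ·LT invLT Mom) ≐ᴹ idMat
  Mom-invertible = invLT-inverse Mom Mom-lower Mom-diagonal
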